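{- Let $q=p^m$ with $p$ an odd prime, $q\equiv 1\pmod 3$ and $q\ge 13$. Then the connected components of $C_P(q)$ are exactly: (1) the isolated vertices, which are precisely the maps $\pi(x)=ax+b$ with $a\neq 0$ (so $\pi(\infty)=\infty$), of which there are $q(q-1)$; and (2) the $q-1$ induced subgraphs $[P_r]$, $r\in GF(q)\setminus\{0\}$, each of which is connected.
   Context: $PGL(2,q)$ is the group of maps $x\mapsto\frac{ax+b}{cx+d}$ ($ad\neq bc$) acting on $GF(q)\cup\{\infty\}$ with the usual conventions ($-d/c\mapsto\infty$, $\infty\mapsto a/c$ if $c\neq0$, $\infty\mapsto\infty$ if $c=0$). For $a,i,r\in GF(q)$, $r\neq0$, $a+\frac{r}{x-i}$ denotes the element of $PGL(2,q)$ mapping $x\notin\{i,\infty\}$ to $a+r(x-i)^{ -1}$, $\infty\mapsto a$, $i\mapsto\infty$. For permutations $\pi,\sigma$, $hd(\pi,\sigma)=|\{x:\pi(x)\neq\sigma(x)\}|$. With distinguished element $\infty$, $\pi^{\triangle}$ is defined by $\pi^{\triangle}(\pi^{ -1}(\infty))=\pi(\infty)$, $\pi^{\triangle}(\infty)=\infty$, $\pi^{\triangle}(x)=\pi(x)$ otherwise. The contraction graph $C_P(q)$ has vertex set $PGL(2,q)$, with distinct $\pi,\sigma$ adjacent iff $hd(\pi^{\triangle},\sigma^{\triangle})=q-4$. For nonzero $r$, $P_r=\{a+\frac{r}{x-i}:a,i\in GF(q)\}$, and $[P_r]$ is the subgraph of $C_P(q)$ induced by $P_r$. -}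

module Defs where

open import Level using (0ℓ)
open import Data.Nat as ℕ using (ℕ; _∸_; _%_)
open import Data.Fin using (Fin)
open import Data.List using (List; _∷_; map; filter; length; allFin)
open import Data.Maybe using (Maybe; just; nothing)
open import Data.Product using (Σ; _×_; _,_; ∃-syntax)
open import Data.Sum using (_⊎_)
open import Data.Unit using (⊤)
open import Relation.Nullary using (¬_; Dec; yes; no)
open import Relation.Nullary.Decidable using (¬?)
open import Relation.Binary.PropositionalEquality using (_≡_)
open import Relation.Binary.Definitions using (DecidableEquality)
open import Algebra.Structures using (IsCommutativeRing)
open import Function.Bundles using (_↔_; Inverse)

-- A finite field, with propositional equality.  Since a finite field of
-- order q is unique up to isomorphism, quantifying over all finite fields
-- of order q is quantifying over GF(q).
record FiniteField : Set₁ where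
  infixl 7 _*_
  infixl 6 _+_
  field
    Carrier : Set
    _≟_     : DecidableEquality Carrier
    _+_ _*_ : Carrier → Carrier → Carrier
    -_      : Carrier → Carrier
    0# 1#   : Carrier
    isCommutativeRing : IsCommutativeRing _≡_ _+_ _*_ -_ 0# 1#
    0≢1     : ¬ (0# ≡ 1#)
    _⁻¹     : Carrier → Carrier
    inverse : ∀ x → ¬ (x ≡ 0#) → x * (x ⁻¹) ≡ 1#
    size    : ℕ
    enum    : Carrier ↔ Fin size

module GF (𝔽 : FiniteField) where
  open FiniteField 𝔽 public

  q : ℕ
  q = size

  Pt : Set
  Pt = Maybe Carrier

  ∞ : Pt
  ∞ = nothing

  _≟P_ : DecidableEquality Pt
  nothing ≟P nothing = yes _≡_.refl
  nothing ≟P just _  = no (λ ())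
  just _  ≟P nothing = no (λ ())
  just x  ≟P just y with x ≟ y
  ... | yes _≡_.refl = yes _≡_.refl
  ... | no x≢y = no (λ { _≡_.refl → x≢y _≡_.refl })

  allPts : List Pt
  allPts = nothing ∷ map (λ i → just (Inverse.from enum i)) (allFin size)

  hd : (Pt → Pt) → (Pt → Pt) → ℕ
  hd π σ = length (filter (λ x → ¬? (π x ≟P σ x)) allPts)

  record PGL : Set where
    constructor mat
    field
      a b c d : Carrier
      nondeg  : ¬ (a * d ≡ b * c)

  apply : PGL → Pt → Pt
  apply (mat a b c d _) (just x) with (c * x + d) ≟ 0#
  ... | yes _ = nothing
  ... | no _  = just ((a * x + b) * ((c * x + d) ⁻¹))
  apply (mat a b c d _) nothing with c ≟ 0#
  ... | yes _ = nothing
  ... | no _  = just (a * (c ⁻¹))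

  -- PGL(2,q) is a group of maps: two representatives denote the same
  -- vertex iff they induce the same map
  _≈_ : PGL → PGL → Set
  π ≈ σ = ∀ x → apply π x ≡ apply σ x

  tri : (Pt → Pt) → Pt → Pt
  tri π nothing = nothing
  tri π (just x) with π (just x)
  ... | nothing = π nothing
  ... | just y  = just y

  Adj : PGL → PGL → Set
  Adj π σ = ¬ (π ≈ σ) × hd (tri (apply π)) (tri (apply σ)) ≡ q ∸ 4

  Isolated : PGL → Set
  Isolated π = ∀ σ → ¬ Adj π σ

  affine : Carrier → Carrier → Pt → Pt
  affine a b nothing  = nothing
  affine a b (just x) = just (a * x + b)

  IsAffine : PGL → Set
  IsAffine π = ∃[ a ] ∃[ b ] (¬ (a ≡ 0#) × (∀ x → apply π x ≡ affine a b x))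

  frac : Carrier → Carrier → Carrier → Pt → Pt
  frac a i r nothing = just a
  frac a i r (just x) with x ≟ i
  ... | yes _ = nothing
  ... | no _  = just (a + r * ((x + (- i)) ⁻¹))

  InP : Carrier → PGL → Set
  InP r π = ∃[ a ] ∃[ i ] (∀ x → apply π x ≡ frac a i r x)

  data PathIn (S : PGL → Set) : PGL → PGL → Set where
    here : ∀ {π σ} → S π → π ≈ σ → PathIn S π σ
    step : ∀ {π σ τ} → S π → Adj π σ → PathIn S σ τ → PathIn S π τ

  Everything : PGL → Set
  Everything _ = ⊤

-- Every element of PGL(2,q) is either affine, x ↦ ax + b, or a fraction a + r/(x - i) with r ≠ 0, and two
-- vertices are adjacent iff their contractions agree at exactly five of the q + 1 points.  The contractions of
-- two affine maps, of an affine map and a fraction, or of two fractions with different r agree only at ∞, at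
-- one pole and at the roots of a nonzero quadratic, hence at most four points: the affine maps are isolated
-- and every edge stays inside one class P_r.  Conversely, take u with u² - u + 1 = 0 and 2u ≠ 1.  It exists
-- because ρ x = 1 - 1/x permutes GF(q) ∖ {0, 1} with orbits of size 1 or 3 and its fixed points are the roots
-- of x² - x + 1; as q - 2 ≡ 2 (mod 3) there are at least two of them, so not both equal 1/2.  Then
-- a + αβ/(x - i) and a + α + αβ/(x - i - β) agree exactly at ∞, i, i + β, i + βu and i + β(1 - u).  These
-- edges move the pole by any β ≠ 0, and three of them whose pole shifts cancel change the value a arbitrarily,
-- so every [P_r] is connected.

module Submission where

open import Defs
import Data.Nat as ℕ
open import Data.Nat using (ℕ; _∸_; _^_; _%_; _≤_)
open import Data.Nat.Primality using (Prime)
open import Data.Fin using (Fin)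
open import Data.Product using (Σ; _×_; _,_; ∃-syntax; proj₁)
open import Data.Sum using (_⊎_)
open import Relation.Nullary using (¬_)
open import Relation.Binary.PropositionalEquality using (_≡_)
open import Function.Bundles using (_⇔_)
open import Algebra.Bundles using (CommutativeRing)
open import Data.Nat.Properties using (≤-trans; m≤m+n)

module _ where
  open import Data.Empty using (⊥-elim)
  open import Data.Fin using (Fin; zero; suc; punchIn; punchOut)
  open import Data.Fin.Properties using (injective⇒≤; punchIn-injective; punchInᵢ≢i; punchIn-punchOut)
  open import Data.List using (List; []; _∷_; length; filter; lookup)
  open import Data.List.Membership.Propositional using (_∈_)
  open import Data.List.Membership.Propositional.Properties using (∈-lookup; ∈-filter⁺; ∈-filter⁻)
  open import Data.List.Properties using (filter-reject)
  open import Data.List.Relation.Binary.Subset.Propositional using (_⊆_)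
  open import Data.List.Relation.Unary.All as All using ([]; _∷_)
  open import Data.List.Relation.Unary.AllPairs using ([]; _∷_)
  open import Data.List.Relation.Unary.Any as Any using (here; there)
  open import Data.List.Relation.Unary.Any.Properties using (lookup-index)
  open import Data.List.Relation.Unary.Unique.Propositional using (Unique)
  import Data.List.Relation.Unary.Unique.Propositional.Properties as Unique
  open import Data.Nat using (ℕ; zero; suc; _+_; _*_; _∸_; _≤_; s≤s)
  import Data.Nat.Properties as ℕ
  open import Data.Nat.Properties using (≤-antisym; ≤-trans; ≤-reflexive; ≤-pred; ≤-refl)
  open import Data.Product using (∃-syntax; _,_; proj₁; proj₂)
  open import Level using (Level)
  open import Relation.Binary.Definitions using (DecidableEquality)
  open import Relation.Binary.PropositionalEquality
  open import Relation.Nullary using (yes; no)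
  open import Relation.Nullary.Decidable using (¬?)
  open import Relation.Unary using (Pred; Decidable)

  module _ {A : Set} where

    lookup-injective : ∀ {xs : List A} → Unique xs → ∀ {i j} → lookup xs i ≡ lookup xs j → i ≡ j
    lookup-injective (x∉xs ∷ _) {zero}  {zero}  _  = refl
    lookup-injective (x∉xs ∷ _) {zero}  {suc j} eq = ⊥-elim (All.lookup x∉xs (∈-lookup j) eq)
    lookup-injective (x∉xs ∷ _) {suc i} {zero}  eq = ⊥-elim (All.lookup x∉xs (∈-lookup i) (sym eq))
    lookup-injective (_ ∷ xs!)  {suc i} {suc j} eq = cong suc (lookup-injective xs! eq)

    Unique-⊆⇒length≤ : ∀ {xs ys : List A} → Unique xs → xs ⊆ ys → length xs ≤ length ys
    Unique-⊆⇒length≤ {xs} {ys} xs! xs⊆ys = injective⇒≤ index-injective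
      where
      index : Fin (length xs) → Fin (length ys)
      index i = Any.index (xs⊆ys (∈-lookup i))
      index-injective : ∀ {i j} → index i ≡ index j → i ≡ j
      index-injective {i} {j} eq = lookup-injective xs!
        (trans (lookup-index (xs⊆ys (∈-lookup i)))
          (trans (cong (lookup ys) eq) (sym (lookup-index (xs⊆ys (∈-lookup j))))))

    module _ {ℓ : Level} {P : Pred A ℓ} (P? : Decidable P) where

      length-filter-∁ : ∀ xs → length xs ≡ length (filter P? xs) + length (filter (λ x → ¬? (P? x)) xs)
      length-filter-∁ [] = refl
      length-filter-∁ (x ∷ xs) with P? x
      ... | yes _ = cong suc (length-filter-∁ xs)
      ... | no _  = trans (cong suc (length-filter-∁ xs)) (sym (ℕ.+-suc _ _))

  module _ {A : Set} (_≟_ : DecidableEquality A) where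
    open import Data.List.Membership.DecPropositional _≟_ using (_∈?_)

    length-filter-⊆ : ∀ {O L} → Unique O → Unique L → O ⊆ L → length (filter (_∈? O) L) ≡ length O
    length-filter-⊆ {O} {L} O! L! O⊆L = ≤-antisym
      (Unique-⊆⇒length≤ (Unique.filter⁺ (_∈? O) L!) (λ m → proj₂ (∈-filter⁻ (_∈? O) {xs = L} m)))
      (Unique-⊆⇒length≤ O! (λ m → ∈-filter⁺ (_∈? O) (O⊆L m) m))

  module Orbits {A : Set} (_≟_ : DecidableEquality A) (ρ : A → A) where
    open import Data.List.Membership.DecPropositional _≟_ using (_∈?_)

    Fixed? : Decidable (λ x → ρ x ≡ x)
    Fixed? x = ρ x ≟ x

    fixedPoints : List A → List A
    fixedPoints = filter Fixed?

    Closed : List A → Set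
    Closed L = ∀ {x} → x ∈ L → ρ x ∈ L

    Order3On : List A → Set
    Order3On L = ∀ {x} → x ∈ L → ρ (ρ (ρ x)) ≡ x

    module Orbit {x} (ρx≢x : ρ x ≢ x) (ρ³x≡x : ρ (ρ (ρ x)) ≡ x) where
      orbit : List A
      orbit = x ∷ ρ x ∷ ρ (ρ x) ∷ []

      private
        x≢ρx : x ≢ ρ x
        x≢ρx eq = ρx≢x (sym eq)
        x≢ρ²x : x ≢ ρ (ρ x)
        x≢ρ²x eq = ρx≢x (trans (cong ρ eq) ρ³x≡x)
        ρx≢ρ²x : ρ x ≢ ρ (ρ x)
        ρx≢ρ²x eq = ρx≢x (trans eq (trans (cong ρ eq) ρ³x≡x))

      orbit! : Unique orbit
      orbit! = (x≢ρx ∷ x≢ρ²x ∷ []) ∷ (ρx≢ρ²x ∷ []) ∷ [] ∷ []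

      orbit⊆ : ∀ {L} → x ∈ L → Closed L → orbit ⊆ L
      orbit⊆ x∈L closed (here refl)               = x∈L
      orbit⊆ x∈L closed (there (here refl))        = closed x∈L
      orbit⊆ x∈L closed (there (there (here refl))) = closed (closed x∈L)

      orbit-fixedPoint-free : ∀ {y} → y ∈ orbit → ρ y ≢ y
      orbit-fixedPoint-free (here refl)                  = ρx≢x
      orbit-fixedPoint-free (there (here refl)) eq       = ρx≢ρ²x (sym eq)
      orbit-fixedPoint-free (there (there (here refl))) eq = x≢ρ²x (trans (sym ρ³x≡x) eq)

      ρ-preimage : ∀ {y} → ρ (ρ (ρ y)) ≡ y → ρ y ∈ orbit → y ∈ orbit
      ρ-preimage ρ³y≡y (here eq)               = there (there (here (trans (sym ρ³y≡y) (cong (λ t → ρ (ρ t)) eq))))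
      ρ-preimage ρ³y≡y (there (here eq))        = here (trans (sym ρ³y≡y) (trans (cong (λ t → ρ (ρ t)) eq) ρ³x≡x))
      ρ-preimage ρ³y≡y (there (there (here eq))) =
        there (here (trans (sym ρ³y≡y) (trans (cong (λ t → ρ (ρ t)) eq) (cong ρ ρ³x≡x))))

    fixedPoints-filter-∉ : ∀ O L → (∀ {y} → y ∈ O → ρ y ≢ y) →
                           length (fixedPoints (filter (λ y → ¬? (y ∈? O)) L)) ≡ length (fixedPoints L)
    fixedPoints-filter-∉ O [] _ = refl
    fixedPoints-filter-∉ O (y ∷ L) O-free with y ∈? O
    ... | yes y∈O with ρ y ≟ y
    ...   | yes fixed = ⊥-elim (O-free y∈O fixed)
    ...   | no _      = fixedPoints-filter-∉ O L O-free
    fixedPoints-filter-∉ O (y ∷ L) O-free | no _ with ρ y ≟ y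
    ...   | yes _ = cong suc (fixedPoints-filter-∉ O L O-free)
    ...   | no _  = fixedPoints-filter-∉ O L O-free

    private
      decomposition : ∀ n L → length L ≤ n → Unique L → Closed L → Order3On L →
                      ∃[ k ] length L ≡ k * 3 + length (fixedPoints L)
      decomposition _ [] _ _ _ _ = 0 , refl
      decomposition (suc n) (x ∷ L) (s≤s len≤n) (x∉L ∷ L!) closed order3 with Fixed? x
      ... | yes fixed = k , trans (cong suc eq) (sym (ℕ.+-suc (k * 3) _))
        where
        -- ρ is injective on L, so nothing in L is sent to the fixed point x
        closed′ : Closed L
        closed′ {y} y∈L with closed (there y∈L)
        ... | there ρy∈L = ρy∈L
        ... | here ρy≡x = ⊥-elim (All.lookup x∉L y∈L
                (sym (trans (sym (order3 (there y∈L))) (trans (cong (λ t → ρ (ρ t)) ρy≡x) (trans (cong ρ fixed) fixed)))))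
        ih = decomposition n L len≤n L! closed′ (λ m → order3 (there m))
        k = proj₁ ih
        eq = proj₂ ih
      ... | no ρx≢x = suc k , (begin
        length (x ∷ L)                              ≡⟨ length≡3+rest ⟩
        3 + length rest                             ≡⟨ cong (3 +_) (proj₂ ih) ⟩
        3 + (k * 3 + length (fixedPoints rest))     ≡⟨ cong (λ t → 3 + (k * 3 + t)) (fixedPoints-filter-∉ orbit (x ∷ L) orbit-fixedPoint-free) ⟩
        3 + (k * 3 + length (fixedPoints (x ∷ L)))  ≡⟨ ℕ.+-assoc 3 (k * 3) _ ⟨
        suc k * 3 + length (fixedPoints (x ∷ L))    ≡⟨ cong (λ t → suc k * 3 + length t) (filter-reject Fixed? ρx≢x) ⟩
        suc k * 3 + length (fixedPoints L)          ∎)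
        where
        open ≡-Reasoning
        open Orbit ρx≢x (order3 (here refl))
        ∉orbit? = λ y → ¬? (y ∈? orbit)
        rest = filter ∉orbit? (x ∷ L)
        rest⊆ : ∀ {y} → y ∈ rest → y ∈ x ∷ L
        rest⊆ m = proj₁ (∈-filter⁻ ∉orbit? m)
        length≡3+rest : length (x ∷ L) ≡ 3 + length rest
        length≡3+rest = trans (length-filter-∁ (_∈? orbit) (x ∷ L))
          (cong (_+ length rest) (length-filter-⊆ _≟_ orbit! (x∉L ∷ L!) (orbit⊆ (here refl) closed)))
        ih = decomposition n rest (≤-trans (ℕ.m≤n+m (length rest) 2) (≤-pred (≤-trans (≤-reflexive (sym length≡3+rest)) (s≤s len≤n))))
          (Unique.filter⁺ ∉orbit? (x∉L ∷ L!))
          (λ m → ∈-filter⁺ ∉orbit? (closed (rest⊆ m)) (λ ρy∈O → proj₂ (∈-filter⁻ ∉orbit? m) (ρ-preimage (order3 (rest⊆ m)) ρy∈O)))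
          (λ m → order3 (rest⊆ m))
        k = proj₁ ih

    -- the non-fixed points fall into orbits {x, ρ x, ρ² x} of size three
    length≡3k+fixedPoints : ∀ L → Unique L → Closed L → Order3On L → ∃[ k ] length L ≡ k * 3 + length (fixedPoints L)
    length≡3k+fixedPoints L = decomposition (length L) L ≤-refl

  punchIn′ : ∀ {n} → Fin n → Fin (n ∸ 1) → Fin n
  punchIn′ {suc _} = punchIn

  punchIn′-injective : ∀ {n} (i : Fin n) {j k} → punchIn′ i j ≡ punchIn′ i k → j ≡ k
  punchIn′-injective {suc _} i {j} {k} = punchIn-injective i j k

  punchIn′ᵢ≢i : ∀ {n} (i : Fin n) j → punchIn′ i j ≢ i
  punchIn′ᵢ≢i {suc _} = punchInᵢ≢i

  punchIn′-surjective : ∀ {n} {i j : Fin n} → i ≢ j → ∃[ k ] punchIn′ i k ≡ j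
  punchIn′-surjective {suc _} i≢j = punchOut i≢j , punchIn-punchOut i≢j

module IntegerCoefficients {c ℓ} (R : CommutativeRing c ℓ) where

  open import Algebra.Solver.Ring.AlmostCommutativeRing using (_-Raw-AlmostCommutative⟶_; fromCommutativeRing)
  open import Data.Integer as ℤ using (ℤ; -[1+_]; _⊖_)
  import Data.Integer.Properties as ℤ
  open import Data.Maybe as Maybe using (Maybe)
  open import Data.Nat as ℕ using (zero; suc)
  import Data.Nat.Properties as ℕ
  open import Relation.Binary.PropositionalEquality as ≡ using ()
  open import Relation.Nullary.Decidable using (dec⇒maybe)

  open CommutativeRing R
  open import Algebra.Properties.Ring ring using (-‿involutive; -0#≈0#; -‿distribˡ-*; -‿distribʳ-*)
  open import Algebra.Properties.AbelianGroup +-abelianGroup using (⁻¹-∙-comm)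
  open import Algebra.Properties.CommutativeSemigroup +-commutativeSemigroup using (interchange)
  open import Algebra.Properties.Semiring.Mult.TCOptimised semiring
    using (1+×; ×-homo-+; ×1-homo-*) renaming (_×_ to _×′_)
  open import Relation.Binary.Reasoning.Setoid setoid

  -- the optimised _×′_ has 1 ×′ x = x definitionally, so the solver constant con (+ 1) denotes 1#
  fromℤ : ℤ → Carrier
  fromℤ (ℤ.+ n)    = n ×′ 1#
  fromℤ (-[1+ n ]) = - (suc n ×′ 1#)

  private
    [x+a]-[x+b]≈a-b : ∀ x a b → (x + a) - (x + b) ≈ a - b
    [x+a]-[x+b]≈a-b x a b = begin
      (x + a) + - (x + b)    ≈⟨ +-congˡ (sym (⁻¹-∙-comm x b)) ⟩
      (x + a) + (- x + - b)  ≈⟨ interchange x a (- x) (- b) ⟩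
      (x + - x) + (a + - b)  ≈⟨ +-congʳ (-‿inverseʳ x) ⟩
      0# + (a + - b)         ≈⟨ +-identityˡ _ ⟩
      a - b                  ∎

  fromℤ-⊖ : ∀ m n → fromℤ (m ⊖ n) ≈ m ×′ 1# - n ×′ 1#
  fromℤ-⊖ zero    zero    = sym (trans (+-identityˡ _) -0#≈0#)
  fromℤ-⊖ zero    (suc n) = sym (+-identityˡ _)
  fromℤ-⊖ (suc m) zero    = sym (trans (+-congˡ -0#≈0#) (+-identityʳ _))
  fromℤ-⊖ (suc m) (suc n) = begin
    fromℤ (suc m ⊖ suc n)             ≡⟨ ≡.cong fromℤ (ℤ.[1+m]⊖[1+n]≡m⊖n m n) ⟩
    fromℤ (m ⊖ n)                     ≈⟨ fromℤ-⊖ m n ⟩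
    m ×′ 1# - n ×′ 1#                 ≈⟨ [x+a]-[x+b]≈a-b 1# (m ×′ 1#) (n ×′ 1#) ⟨
    (1# + m ×′ 1#) - (1# + n ×′ 1#)   ≈⟨ +-cong (1+× m 1#) (-‿cong (1+× n 1#)) ⟨
    suc m ×′ 1# - suc n ×′ 1#         ∎

  fromℤ-+ : ∀ i j → fromℤ (i ℤ.+ j) ≈ fromℤ i + fromℤ j
  fromℤ-+ (ℤ.+ m)  (ℤ.+ n)  = ×-homo-+ 1# m n
  fromℤ-+ (ℤ.+ m)  -[1+ n ] = fromℤ-⊖ m (suc n)
  fromℤ-+ -[1+ m ] (ℤ.+ n)  = trans (fromℤ-⊖ n (suc m)) (+-comm _ _)
  fromℤ-+ -[1+ m ] -[1+ n ] = begin
    - (suc (suc (m ℕ.+ n)) ×′ 1#)      ≡⟨ ≡.cong (λ k → - (suc k ×′ 1#)) (ℕ.+-suc m n) ⟨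
    - ((suc m ℕ.+ suc n) ×′ 1#)        ≈⟨ -‿cong (×-homo-+ 1# (suc m) (suc n)) ⟩
    - (suc m ×′ 1# + suc n ×′ 1#)      ≈⟨ ⁻¹-∙-comm _ _ ⟨
    - (suc m ×′ 1#) + - (suc n ×′ 1#)  ∎

  fromℤ-neg : ∀ i → fromℤ (ℤ.- i) ≈ - fromℤ i
  fromℤ-neg (ℤ.+ zero)  = sym -0#≈0#
  fromℤ-neg (ℤ.+ suc n) = refl
  fromℤ-neg -[1+ n ]    = sym (-‿involutive _)

  private
    fromℤ-+*+ : ∀ m n → fromℤ (ℤ.+ m ℤ.* ℤ.+ n) ≈ fromℤ (ℤ.+ m) * fromℤ (ℤ.+ n)
    fromℤ-+*+ m n = trans (reflexive (≡.cong fromℤ (≡.sym (ℤ.pos-* m n)))) (×1-homo-* m n)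

    fromℤ-+*- : ∀ m n → fromℤ (ℤ.+ m ℤ.* -[1+ n ]) ≈ fromℤ (ℤ.+ m) * fromℤ -[1+ n ]
    fromℤ-+*- m n = begin
      fromℤ (ℤ.+ m ℤ.* ℤ.- ℤ.+ suc n)    ≡⟨ ≡.cong fromℤ (ℤ.neg-distribʳ-* (ℤ.+ m) (ℤ.+ suc n)) ⟨
      fromℤ (ℤ.- (ℤ.+ m ℤ.* ℤ.+ suc n))  ≈⟨ fromℤ-neg (ℤ.+ m ℤ.* ℤ.+ suc n) ⟩
      - fromℤ (ℤ.+ m ℤ.* ℤ.+ suc n)      ≈⟨ -‿cong (fromℤ-+*+ m (suc n)) ⟩
      - (m ×′ 1# * suc n ×′ 1#)          ≈⟨ -‿distribʳ-* _ _ ⟩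
      m ×′ 1# * - (suc n ×′ 1#)          ∎

    fromℤ-neg* : ∀ i j → fromℤ (i ℤ.* j) ≈ fromℤ i * fromℤ j → fromℤ (ℤ.- i ℤ.* j) ≈ fromℤ (ℤ.- i) * fromℤ j
    fromℤ-neg* i j hom = begin
      fromℤ (ℤ.- i ℤ.* j)      ≡⟨ ≡.cong fromℤ (ℤ.neg-distribˡ-* i j) ⟨
      fromℤ (ℤ.- (i ℤ.* j))    ≈⟨ fromℤ-neg (i ℤ.* j) ⟩
      - fromℤ (i ℤ.* j)        ≈⟨ -‿cong hom ⟩
      - (fromℤ i * fromℤ j)    ≈⟨ -‿distribˡ-* _ _ ⟩
      - fromℤ i * fromℤ j      ≈⟨ *-congʳ (fromℤ-neg i) ⟨
      fromℤ (ℤ.- i) * fromℤ j  ∎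

  fromℤ-* : ∀ i j → fromℤ (i ℤ.* j) ≈ fromℤ i * fromℤ j
  fromℤ-* (ℤ.+ m)  (ℤ.+ n)  = fromℤ-+*+ m n
  fromℤ-* (ℤ.+ m)  -[1+ n ] = fromℤ-+*- m n
  fromℤ-* -[1+ m ] (ℤ.+ n)  = fromℤ-neg* (ℤ.+ suc m) (ℤ.+ n) (fromℤ-+*+ (suc m) n)
  fromℤ-* -[1+ m ] -[1+ n ] = fromℤ-neg* (ℤ.+ suc m) -[1+ n ] (fromℤ-+*- (suc m) n)

  ℤ⟶R : ℤ.+-*-rawRing -Raw-AlmostCommutative⟶ fromCommutativeRing R
  ℤ⟶R = record
    { ⟦_⟧ = fromℤ ; +-homo = fromℤ-+ ; *-homo = fromℤ-* ; -‿homo = fromℤ-neg ; 0-homo = refl ; 1-homo = refl }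

  _ℤ≟_ : ∀ i j → Maybe (fromℤ i ≈ fromℤ j)
  i ℤ≟ j = Maybe.map (λ { ≡.refl → refl }) (dec⇒maybe (i ℤ.≟ j))

  open import Algebra.Solver.Ring ℤ.+-*-rawRing (fromCommutativeRing R) ℤ⟶R _ℤ≟_ public
    using (solve; _:=_; _:+_; _:-_; _:*_; :-_; con; Polynomial)

module Field (𝔽 : FiniteField) where
  open import Data.Empty using (⊥-elim)
  open import Data.Fin using (Fin)
  open import Data.Integer as ℤ using ()
  open import Data.List using (List; []; _∷_; length; map; allFin)
  open import Data.List.Membership.Propositional using (_∈_; _∉_)
  open import Data.List.Membership.Propositional.Properties using (∈-map⁺; ∈-allFin)
  open import Data.List.Properties using (length-map; length-tabulate; map-∘)
  open import Data.List.Relation.Unary.All as All using ([]; _∷_)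
  open import Data.List.Relation.Unary.All.Properties using (¬All⇒Any¬)
  open import Data.List.Relation.Unary.AllPairs using ([]; _∷_)
  open import Data.List.Relation.Unary.Any as Any using (here; there)
  open import Data.List.Relation.Unary.Unique.Propositional using (Unique)
  import Data.List.Relation.Unary.Unique.Propositional.Properties as Unique
  open import Data.Maybe using (just; nothing)
  open import Data.Maybe.Properties using (just-injective)
  open import Data.Nat using (suc; _≤_; _<_; z≤n; s≤s)
  open import Data.Nat.Properties using (<⇒≱)
  open import Data.Product using (∃-syntax; _×_; _,_)
  open import Data.Sum using (_⊎_; inj₁; inj₂)
  open import Function.Bundles using (Inverse)
  open import Relation.Binary.PropositionalEquality
  open import Relation.Nullary using (¬_; yes; no)

  open GF 𝔽 public

  commutativeRing : CommutativeRing _ _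
  commutativeRing = record { isCommutativeRing = isCommutativeRing }

  open CommutativeRing commutativeRing public
    using (_-_; +-assoc; +-comm; *-assoc; *-comm; +-identityˡ; +-identityʳ; *-identityˡ; *-identityʳ;
           -‿inverseʳ; zeroˡ; zeroʳ)
  open import Algebra.Properties.Ring (CommutativeRing.ring commutativeRing) public using (+-cancelˡ; -‿involutive; -0#≈0#)
  open import Data.List.Membership.DecPropositional _≟_ using (_∈?_)
  open IntegerCoefficients commutativeRing public using (solve; _:=_; _:+_; _:-_; _:*_; :-_; con; Polynomial)

  :0 :1 : ∀ {n} → Polynomial n
  :0 = con (ℤ.+ 0)
  :1 = con (ℤ.+ 1)

  1≢0 : 1# ≢ 0#
  1≢0 eq = 0≢1 (sym eq)

  1⁻¹≡1 : 1# ⁻¹ ≡ 1#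
  1⁻¹≡1 = trans (sym (*-identityˡ _)) (inverse 1# 1≢0)

  x⁻¹*x≡1 : ∀ {x} → x ≢ 0# → x ⁻¹ * x ≡ 1#
  x⁻¹*x≡1 {x} x≢0 = trans (*-comm _ _) (inverse x x≢0)

  x⁻¹*[x*y]≡y : ∀ {x} y → x ≢ 0# → x ⁻¹ * (x * y) ≡ y
  x⁻¹*[x*y]≡y {x} y x≢0 = trans (sym (*-assoc _ _ _)) (trans (cong (_* y) (x⁻¹*x≡1 x≢0)) (*-identityˡ y))

  [y*x⁻¹]*x≡y : ∀ y {x} → x ≢ 0# → (y * x ⁻¹) * x ≡ y
  [y*x⁻¹]*x≡y y {x} x≢0 = trans (*-assoc _ _ _) (trans (cong (y *_) (x⁻¹*x≡1 x≢0)) (*-identityʳ y))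

  x*y≡0⇒x≡0⊎y≡0 : ∀ {x y} → x * y ≡ 0# → x ≡ 0# ⊎ y ≡ 0#
  x*y≡0⇒x≡0⊎y≡0 {x} {y} xy≡0 with x ≟ 0#
  ... | yes x≡0 = inj₁ x≡0
  ... | no x≢0  = inj₂ (trans (sym (x⁻¹*[x*y]≡y y x≢0)) (trans (cong (x ⁻¹ *_) xy≡0) (zeroʳ _)))

  *-≢0 : ∀ {x y} → x ≢ 0# → y ≢ 0# → x * y ≢ 0#
  *-≢0 x≢0 y≢0 xy≡0 with x*y≡0⇒x≡0⊎y≡0 xy≡0
  ... | inj₁ x≡0 = x≢0 x≡0
  ... | inj₂ y≡0 = y≢0 y≡0

  ⁻¹-≢0 : ∀ {x} → x ≢ 0# → x ⁻¹ ≢ 0#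
  ⁻¹-≢0 {x} x≢0 x⁻¹≡0 = 1≢0 (trans (sym (inverse x x≢0)) (trans (cong (x *_) x⁻¹≡0) (zeroʳ x)))

  *-cancelʳ : ∀ {x y z} → z ≢ 0# → x * z ≡ y * z → x ≡ y
  *-cancelʳ {x} {y} {z} z≢0 eq = begin
    x                ≡⟨ x⁻¹*[x*y]≡y x z≢0 ⟨
    z ⁻¹ * (z * x)   ≡⟨ cong (z ⁻¹ *_) (trans (*-comm z x) (trans eq (*-comm y z))) ⟩
    z ⁻¹ * (z * y)   ≡⟨ x⁻¹*[x*y]≡y y z≢0 ⟩
    y                ∎ where open ≡-Reasoning

  x-y≡0⇒x≡y : ∀ {x y} → x - y ≡ 0# → x ≡ y
  x-y≡0⇒x≡y {x} {y} eq = begin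
    x            ≡⟨ solve 2 (λ x y → x := (x :- y) :+ y) refl x y ⟩
    (x - y) + y  ≡⟨ cong (_+ y) eq ⟩
    0# + y       ≡⟨ +-identityˡ y ⟩
    y            ∎ where open ≡-Reasoning

  x≡y⇒x-y≡0 : ∀ {x y} → x ≡ y → x - y ≡ 0#
  x≡y⇒x-y≡0 {x} refl = -‿inverseʳ x

  x≢y⇒x-y≢0 : ∀ {x y} → x ≢ y → x - y ≢ 0#
  x≢y⇒x-y≢0 x≢y eq = x≢y (x-y≡0⇒x≡y eq)

  x*y≡1⇒x⁻¹≡y : ∀ {x y} → x ≢ 0# → x * y ≡ 1# → x ⁻¹ ≡ y
  x*y≡1⇒x⁻¹≡y {x} {y} x≢0 xy≡1 = trans (sym (*-identityʳ _)) (trans (cong (x ⁻¹ *_) (sym xy≡1)) (x⁻¹*[x*y]≡y y x≢0))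

  ⁻¹-distrib-* : ∀ {x y} → x ≢ 0# → y ≢ 0# → (x * y) ⁻¹ ≡ x ⁻¹ * y ⁻¹
  ⁻¹-distrib-* {x} {y} x≢0 y≢0 = x*y≡1⇒x⁻¹≡y (*-≢0 x≢0 y≢0) (begin
    x * y * (x ⁻¹ * y ⁻¹)      ≡⟨ solve 4 (λ x y e f → x :* y :* (e :* f) := (x :* e) :* (y :* f)) refl x y (x ⁻¹) (y ⁻¹) ⟩
    (x * x ⁻¹) * (y * y ⁻¹)    ≡⟨ cong₂ _*_ (inverse x x≢0) (inverse y y≢0) ⟩
    1# * 1#                    ≡⟨ *-identityˡ 1# ⟩
    1#                         ∎)
    where open ≡-Reasoning

  -‿≢0 : ∀ {x} → x ≢ 0# → - x ≢ 0#
  -‿≢0 {x} x≢0 -x≡0 = x≢0 (trans (sym (-‿involutive x)) (trans (cong -_ -x≡0) -0#≈0#))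

  ⁻¹-distrib-neg : ∀ {x} → x ≢ 0# → (- x) ⁻¹ ≡ - (x ⁻¹)
  ⁻¹-distrib-neg {x} x≢0 = x*y≡1⇒x⁻¹≡y (-‿≢0 x≢0)
    (trans (solve 2 (λ x e → :- x :* :- e := x :* e) refl x (x ⁻¹)) (inverse x x≢0))

  x*x⁻¹-1≡0 : ∀ {x} → x ≢ 0# → x * x ⁻¹ - 1# ≡ 0#
  x*x⁻¹-1≡0 {x} x≢0 = x≡y⇒x-y≡0 (inverse x x≢0)

  x≢x+t : ∀ {x t} → t ≢ 0# → x ≢ x + t
  x≢x+t {x} {t} t≢0 eq = t≢0 (trans (solve 2 (λ x t → t := x :+ t :- x) refl x t) (x≡y⇒x-y≡0 (sym eq)))

  x+s≢x+t : ∀ {x s t} → s ≢ t → x + s ≢ x + t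
  x+s≢x+t {x} {s} {t} s≢t eq = s≢t (x-y≡0⇒x≡y (trans (solve 3 (λ x s t → s :- t := x :+ s :- (x :+ t)) refl x s t) (x≡y⇒x-y≡0 eq)))

  x+y-x-y≡0 : ∀ x y → x + y - x - y ≡ 0#
  x+y-x-y≡0 = solve 2 (λ x y → x :+ y :- x :- y := :0) refl

  x-y-z≡0⇒x≡y+z : ∀ {x y z} → x - y - z ≡ 0# → x ≡ y + z
  x-y-z≡0⇒x≡y+z {x} {y} {z} eq = x-y≡0⇒x≡y (trans (solve 3 (λ x y z → x :- (y :+ z) := x :- y :- z) refl x y z) eq)

  *-cancelˡ-≢ : ∀ {x s t} → x ≢ 0# → s ≢ t → x * s ≢ x * t
  *-cancelˡ-≢ {x} {s} {t} x≢0 s≢t eq = s≢t (*-cancelʳ x≢0 (trans (*-comm s x) (trans eq (*-comm x t))))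

  -- the solver cannot use hypotheses: P ≡ Q is proved from a polynomial identity P = Q + K E and E ≡ 0
  ≡-modulo : ∀ {E P Q} K → E ≡ 0# → P ≡ Q + K * E → P ≡ Q
  ≡-modulo {E} {P} {Q} K E≡0 eq = trans eq (trans (cong (λ t → Q + K * t) E≡0) (trans (cong (Q +_) (zeroʳ K)) (+-identityʳ Q)))

  a+r/d≡[ad+r]/d : ∀ a r {d} → d ≢ 0# → a + r * d ⁻¹ ≡ (a * d + r) * d ⁻¹
  a+r/d≡[ad+r]/d a r {d} d≢0 = begin
    a + r * d ⁻¹                ≡⟨ cong (_+ r * d ⁻¹) (*-identityʳ a) ⟨
    a * 1# + r * d ⁻¹           ≡⟨ cong (λ t → a * t + r * d ⁻¹) (inverse d d≢0) ⟨
    a * (d * d ⁻¹) + r * d ⁻¹   ≡⟨ solve 4 (λ a d e r → a :* (d :* e) :+ r :* e := (a :* d :+ r) :* e) refl a d (d ⁻¹) r ⟩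
    (a * d + r) * d ⁻¹          ∎ where open ≡-Reasoning

  /-cross⇒ : ∀ {n₁ d₁ n₂ d₂} → d₁ ≢ 0# → d₂ ≢ 0# → n₁ * d₁ ⁻¹ ≡ n₂ * d₂ ⁻¹ → n₁ * d₂ ≡ n₂ * d₁
  /-cross⇒ {n₁} {d₁} {n₂} {d₂} d₁≢0 d₂≢0 eq = begin
    n₁ * d₂                   ≡⟨ cong (_* d₂) ([y*x⁻¹]*x≡y n₁ d₁≢0) ⟨
    ((n₁ * d₁ ⁻¹) * d₁) * d₂  ≡⟨ cong (λ t → (t * d₁) * d₂) eq ⟩
    ((n₂ * d₂ ⁻¹) * d₁) * d₂  ≡⟨ solve 4 (λ a b c d → (a :* b :* c) :* d := (a :* b :* d) :* c) refl n₂ (d₂ ⁻¹) d₁ d₂ ⟩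
    ((n₂ * d₂ ⁻¹) * d₂) * d₁  ≡⟨ cong (_* d₁) ([y*x⁻¹]*x≡y n₂ d₂≢0) ⟩
    n₂ * d₁                   ∎ where open ≡-Reasoning

  /-cross⇐ : ∀ {n₁ d₁ n₂ d₂} → d₁ ≢ 0# → d₂ ≢ 0# → n₁ * d₂ ≡ n₂ * d₁ → n₁ * d₁ ⁻¹ ≡ n₂ * d₂ ⁻¹
  /-cross⇐ {n₁} {d₁} {n₂} {d₂} d₁≢0 d₂≢0 eq = *-cancelʳ (*-≢0 d₁≢0 d₂≢0) (begin
    (n₁ * d₁ ⁻¹) * (d₁ * d₂)  ≡⟨ solve 4 (λ a b c d → (a :* b) :* (c :* d) := ((a :* b) :* c) :* d) refl n₁ (d₁ ⁻¹) d₁ d₂ ⟩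
    ((n₁ * d₁ ⁻¹) * d₁) * d₂  ≡⟨ cong (_* d₂) ([y*x⁻¹]*x≡y n₁ d₁≢0) ⟩
    n₁ * d₂                   ≡⟨ eq ⟩
    n₂ * d₁                   ≡⟨ cong (_* d₁) ([y*x⁻¹]*x≡y n₂ d₂≢0) ⟨
    ((n₂ * d₂ ⁻¹) * d₂) * d₁  ≡⟨ solve 4 (λ a b c d → ((a :* b) :* d) :* c := (a :* b) :* (c :* d)) refl n₂ (d₂ ⁻¹) d₁ d₂ ⟩
    (n₂ * d₂ ⁻¹) * (d₁ * d₂)  ∎)
    where open ≡-Reasoning

  y≡n/d⇒y*d≡n : ∀ {y n d} → d ≢ 0# → y ≡ n * d ⁻¹ → y * d ≡ n
  y≡n/d⇒y*d≡n {n = n} d≢0 refl = [y*x⁻¹]*x≡y n d≢0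

  n≡y*d⇒n/d≡y : ∀ {y n d} → d ≢ 0# → n ≡ y * d → n * d ⁻¹ ≡ y
  n≡y*d⇒n/d≡y {y} {d = d} d≢0 refl = trans (*-assoc _ _ _) (trans (cong (y *_) (inverse d d≢0)) (*-identityʳ y))

  elements : List Carrier
  elements = map (Inverse.from enum) (allFin q)

  ∈-elements : ∀ x → x ∈ elements
  ∈-elements x = subst (_∈ elements) (Inverse.strictlyInverseʳ enum x) (∈-map⁺ (Inverse.from enum) (∈-allFin (Inverse.to enum x)))

  from-injective : ∀ {i j} → Inverse.from enum i ≡ Inverse.from enum j → i ≡ j
  from-injective {i} {j} eq = trans (sym (Inverse.strictlyInverseˡ enum i))
    (trans (cong (Inverse.to enum) eq) (Inverse.strictlyInverseˡ enum j))

  to-injective : ∀ {x y} → Inverse.to enum x ≡ Inverse.to enum y → x ≡ y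
  to-injective {x} {y} eq = trans (sym (Inverse.strictlyInverseʳ enum x))
    (trans (cong (Inverse.from enum) eq) (Inverse.strictlyInverseʳ enum y))

  elements! : Unique elements
  elements! = Unique.map⁺ from-injective (Unique.allFin⁺ q)

  length-elements : length elements ≡ q
  length-elements = trans (length-map _ (allFin q)) (length-tabulate (λ i → i))

  ∈-allPts : ∀ x → x ∈ allPts
  ∈-allPts nothing  = here refl
  ∈-allPts (just x) = there (subst (just x ∈_) (sym (map-∘ (allFin q))) (∈-map⁺ just (∈-elements x)))

  allPts! : Unique allPts
  allPts! = ∞∉ (allFin q) ∷ Unique.map⁺ (λ eq → from-injective (just-injective eq)) (Unique.allFin⁺ q)
    where
    ∞∉ : ∀ (is : List (Fin q)) → All.All (nothing ≢_) (map (λ i → just (Inverse.from enum i)) is)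
    ∞∉ []       = []
    ∞∉ (_ ∷ is) = (λ ()) ∷ ∞∉ is

  length-allPts : length allPts ≡ suc q
  length-allPts = cong suc (trans (length-map _ (allFin q)) (length-tabulate (λ i → i)))

  ∃-∉ : ∀ (xs : List Carrier) → length xs < q → ∃[ x ] x ∉ xs
  ∃-∉ xs len<q with All.all? (_∈? xs) elements
  ... | yes all∈ = ⊥-elim (<⇒≱ len<q
          (subst (_≤ length xs) length-elements (Unique-⊆⇒length≤ elements! (All.lookup all∈))))
  ... | no ¬all∈ = Any.satisfied (¬All⇒Any¬ (_∈? xs) elements ¬all∈)

  Quadratic : Carrier → Carrier → Carrier → Carrier → Carrier
  Quadratic A B C x = A * x * x + B * x + C

  -- a root y gives the factorisation Q(x) - Q(y) = (x - y)(A(x + y) + B)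
  quadratic-roots : ∀ A B C → ¬ (A ≡ 0# × B ≡ 0# × C ≡ 0#) →
                    ∃[ rs ] length rs ≤ 2 × (∀ x → Quadratic A B C x ≡ 0# → x ∈ rs)
  quadratic-roots A B C ≢0 with Any.any? (λ x → Quadratic A B C x ≟ 0#) elements
  ... | no noRoot = [] , z≤n , λ x Qx≡0 → ⊥-elim (noRoot (Any.map (λ { refl → Qx≡0 }) (∈-elements x)))
  ... | yes someRoot with Any.satisfied someRoot
  ... | y , Qy≡0 = y ∷ (- y - B * A ⁻¹) ∷ [] , s≤s (s≤s z≤n) , roots
    where
    roots : ∀ x → Quadratic A B C x ≡ 0# → x ∈ y ∷ (- y - B * A ⁻¹) ∷ []
    roots x Qx≡0 with x*y≡0⇒x≡0⊎y≡0 (trans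
      (solve 5 (λ A B C x y → (x :- y) :* (A :* (x :+ y) :+ B) := A :* x :* x :+ B :* x :+ C :- (A :* y :* y :+ B :* y :+ C)) refl A B C x y)
      (trans (cong₂ _-_ Qx≡0 Qy≡0) (-‿inverseʳ 0#)))
    ... | inj₁ x-y≡0 = here (x-y≡0⇒x≡y x-y≡0)
    ... | inj₂ linear≡0 with A ≟ 0#
    ...   | no A≢0 = there (here (≡-modulo (A ⁻¹) linear≡0 (≡-modulo (- x - y) (x≡y⇒x-y≡0 (inverse A A≢0))
            (solve 5 (λ A B e x y → x := :- y :- B :* e :+ e :* (A :* (x :+ y) :+ B) :+ (:- x :- y) :* (A :* e :- :1)) refl A B (A ⁻¹) x y))))
    ...   | yes A≡0 = ⊥-elim (≢0 (A≡0 , B≡0 , C≡0))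
      where
      B≡0 : B ≡ 0#
      B≡0 = trans (solve 4 (λ A B x y → B := A :* (x :+ y) :+ B :- A :* (x :+ y)) refl A B x y)
              (trans (cong₂ (λ s t → s - t * (x + y)) linear≡0 A≡0) (solve 1 (λ t → :0 :- :0 :* t := :0) refl (x + y)))
      C≡0 : C ≡ 0#
      C≡0 = trans (solve 4 (λ A B C y → C := A :* y :* y :+ B :* y :+ C :- (A :* y :* y :+ B :* y)) refl A B C y)
              (trans (cong₂ (λ s t → s - t) Qy≡0 (cong₂ (λ a b → a * y * y + b * y) A≡0 B≡0))
                (solve 1 (λ y → :0 :- (:0 :* y :* y :+ :0 :* y) := :0) refl y))

module Contraction (𝔽 : FiniteField) where
  open import Data.Empty using (⊥-elim)
  open import Data.List using (List; _∷_; length; map; filter)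
  open import Data.List.Membership.Propositional using (_∈_)
  open import Data.List.Membership.Propositional.Properties using (∈-map⁺; ∈-filter⁺; ∈-filter⁻)
  open import Data.List.Properties using (length-map)
  open import Data.List.Relation.Unary.Any using (here; there)
  open import Data.List.Relation.Unary.Unique.Propositional using (Unique)
  import Data.List.Relation.Unary.Unique.Propositional.Properties as Unique
  open import Data.Maybe using (just; nothing)
  open import Data.Maybe.Properties using (just-injective)
  open import Data.Nat as ℕ using (ℕ; suc; _≤_; _∸_; s≤s)
  import Data.Nat.Properties
  open import Data.Nat.Properties using (≤-trans; ≤-reflexive; ≤-antisym; <-irrefl; +-monoˡ-≤; m+[n∸m]≡n; m+n∸m≡n; suc-injective)
  open import Data.Product using (∃-syntax; _×_; _,_; proj₂)
  open import Data.Sum using (_⊎_; inj₁; inj₂)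
  open import Relation.Binary.PropositionalEquality
  open import Relation.Nullary using (¬_; yes; no)

  open Field 𝔽

  Frac : Carrier → Carrier → Carrier → PGL → Set
  Frac r a i π = ∀ x → apply π x ≡ frac a i r x

  frac△ : Carrier → Carrier → Carrier → Pt → Pt
  frac△ a i r nothing = nothing
  frac△ a i r (just x) with x ≟ i
  ... | yes _ = just a
  ... | no _  = just (a + r * (x - i) ⁻¹)

  frac-at-pole : ∀ a i r → frac a i r (just i) ≡ nothing
  frac-at-pole a i r with i ≟ i
  ... | yes _   = refl
  ... | no i≢i  = ⊥-elim (i≢i refl)

  frac-off-pole : ∀ a i r {x} → x ≢ i → frac a i r (just x) ≡ just (a + r * (x - i) ⁻¹)
  frac-off-pole a i r {x} x≢i with x ≟ i
  ... | yes x≡i = ⊥-elim (x≢i x≡i)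
  ... | no _    = refl

  frac△-at-pole : ∀ a i r → frac△ a i r (just i) ≡ just a
  frac△-at-pole a i r with i ≟ i
  ... | yes _  = refl
  ... | no i≢i = ⊥-elim (i≢i refl)

  frac△-off-pole : ∀ a i r {x} → x ≢ i → frac△ a i r (just x) ≡ just (a + r * (x - i) ⁻¹)
  frac△-off-pole a i r {x} x≢i with x ≟ i
  ... | yes x≡i = ⊥-elim (x≢i x≡i)
  ... | no _    = refl

  tri-cong : ∀ {f g : Pt → Pt} → f ≗ g → tri f ≗ tri g
  tri-cong f≗g nothing = refl
  tri-cong {f} {g} f≗g (just x) with f (just x) | g (just x) | f≗g (just x)
  ... | nothing | .nothing  | refl = f≗g nothing
  ... | just y  | .(just y) | refl = refl

  tri-affine : ∀ a b → tri (affine a b) ≗ affine a b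
  tri-affine a b nothing  = refl
  tri-affine a b (just x) = refl

  tri-frac : ∀ a i r → tri (frac a i r) ≗ frac△ a i r
  tri-frac a i r nothing = refl
  tri-frac a i r (just x) with x ≟ i
  ... | yes _ = refl
  ... | no _  = refl

  affine-or-InP : ∀ π → IsAffine π ⊎ ∃[ r ] (r ≢ 0# × InP r π)
  affine-or-InP (mat a b c d ad≢bc) with c ≟ 0#
  ... | yes refl = inj₁ (a * d ⁻¹ , b * d ⁻¹ , *-≢0 a≢0 (⁻¹-≢0 d≢0) , applies)
    where
    d≢0 : d ≢ 0#
    d≢0 d≡0 = ad≢bc (trans (cong (a *_) d≡0) (trans (zeroʳ a) (sym (zeroʳ b))))
    a≢0 : a ≢ 0#
    a≢0 a≡0 = ad≢bc (trans (cong (_* d) a≡0) (trans (zeroˡ d) (sym (zeroʳ b))))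
    0x+d≡d : ∀ x → 0# * x + d ≡ d
    0x+d≡d x = trans (cong (_+ d) (zeroˡ x)) (+-identityˡ d)
    applies : ∀ x → apply (mat a b 0# d ad≢bc) x ≡ affine (a * d ⁻¹) (b * d ⁻¹) x
    applies nothing with 0# ≟ 0#
    ... | yes _   = refl
    ... | no 0≢0  = ⊥-elim (0≢0 refl)
    applies (just x) with (0# * x + d) ≟ 0#
    ... | yes d≡0 = ⊥-elim (d≢0 (trans (sym (0x+d≡d x)) d≡0))
    ... | no _    = cong just (trans (cong (λ t → (a * x + b) * t ⁻¹) (0x+d≡d x))
                      (solve 4 (λ a b x e → (a :* x :+ b) :* e := a :* e :* x :+ b :* e) refl a b x (d ⁻¹)))
  ... | no c≢0 = inj₂ (r , r≢0 , a * c ⁻¹ , i , applies)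
    where
    i = - (d * c ⁻¹)
    r = (b * c - a * d) * (c ⁻¹ * c ⁻¹)
    cc⁻¹-1≡0 = x*x⁻¹-1≡0 c≢0
    r≢0 : r ≢ 0#
    r≢0 = *-≢0 (λ eq → ad≢bc (sym (x-y≡0⇒x≡y eq))) (*-≢0 (⁻¹-≢0 c≢0) (⁻¹-≢0 c≢0))
    applies : Frac r (a * c ⁻¹) i (mat a b c d ad≢bc)
    applies nothing with c ≟ 0#
    ... | yes c≡0 = ⊥-elim (c≢0 c≡0)
    ... | no _    = refl
    applies (just x) with (c * x + d) ≟ 0# | x ≟ i
    ... | yes _ | yes _ = refl
    ... | yes cx+d≡0 | no x≢i = ⊥-elim (x≢i (≡-modulo (c ⁻¹) cx+d≡0 (≡-modulo (- x) cc⁻¹-1≡0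
          (solve 4 (λ c d e x → x := :- (d :* e) :+ e :* (c :* x :+ d) :+ (:- x) :* (c :* e :- :1)) refl c d (c ⁻¹) x))))
    ... | no cx+d≢0 | yes refl = ⊥-elim (cx+d≢0 (≡-modulo (- d) cc⁻¹-1≡0
          (solve 3 (λ c d e → c :* :- (d :* e) :+ d := :0 :+ (:- d) :* (c :* e :- :1)) refl c d (c ⁻¹))))
    ... | no cx+d≢0 | no x≢i = cong just (sym (trans (a+r/d≡[ad+r]/d (a * c ⁻¹) r (x≢y⇒x-y≢0 x≢i))
          (/-cross⇐ (x≢y⇒x-y≢0 x≢i) cx+d≢0 (sym (≡-modulo (- (a * x * x) - b * c * c ⁻¹ * x - b * d * c ⁻¹ - b * x) cc⁻¹-1≡0
            (solve 6 (λ a b c d e x → (a :* x :+ b) :* (x :- :- (d :* e)) := (a :* e :* (x :- :- (d :* e)) :+ (b :* c :- a :* d) :* (e :* e)) :* (c :* x :+ d) :+ (:- (a :* x :* x) :- b :* c :* e :* x :- b :* d :* e :- b :* x) :* (c :* e :- :1)) refl a b c d (c ⁻¹) x))))))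

  affine∉P : ∀ {π r} → IsAffine π → ¬ InP r π
  affine∉P (_ , _ , _ , π≗affine) (_ , _ , π≗frac) with trans (sym (π≗affine nothing)) (π≗frac nothing)
  ... | ()

  AgreementsIn : (Pt → Pt) → (Pt → Pt) → List Pt → Set
  AgreementsIn f g ps = ∀ x → f x ≡ g x → x ∈ ps

  FewAgreements : (Pt → Pt) → (Pt → Pt) → Set
  FewAgreements f g = ∃[ ps ] length ps ≤ 4 × AgreementsIn f g ps

  module _ (f g : Pt → Pt) where
    private
      agree? = λ x → f x ≟P g x
      agreements = filter agree? allPts

      length-agreements+hd : suc q ≡ length agreements ℕ.+ hd f g
      length-agreements+hd = trans (sym length-allPts) (length-filter-∁ agree? allPts)

      agreements≤ : ∀ {ps} → AgreementsIn f g ps → length agreements ≤ length ps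
      agreements≤ within = Unique-⊆⇒length≤ (Unique.filter⁺ agree? allPts!)
        (λ {x} m → within x (proj₂ (∈-filter⁻ agree? {xs = allPts} m)))

    hd≢q∸4 : 4 ≤ q → FewAgreements f g → hd f g ≢ q ∸ 4
    hd≢q∸4 4≤q (ps , len≤4 , within) hd≡q∸4 = <-irrefl refl (begin
      suc q                          ≡⟨ length-agreements+hd ⟩
      length agreements ℕ.+ hd f g   ≤⟨ +-monoˡ-≤ (hd f g) (≤-trans (agreements≤ within) len≤4) ⟩
      4 ℕ.+ hd f g                   ≡⟨ cong (4 ℕ.+_) hd≡q∸4 ⟩
      4 ℕ.+ (q ∸ 4)                  ≡⟨ m+[n∸m]≡n 4≤q ⟩
      q                              ∎)
      where open Data.Nat.Properties.≤-Reasoning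

    hd≡q∸4 : ∀ ps → Unique ps → length ps ≡ 5 → AgreementsIn f g ps → (∀ x → x ∈ ps → f x ≡ g x) → hd f g ≡ q ∸ 4
    hd≡q∸4 ps ps! len≡5 within agree = begin
      hd f g               ≡⟨ m+n∸m≡n 4 (hd f g) ⟨
      4 ℕ.+ hd f g ∸ 4     ≡⟨ cong (_∸ 4) (suc-injective (trans (cong (ℕ._+ hd f g) (sym agreements≡5)) (sym length-agreements+hd))) ⟩
      q ∸ 4                ∎
      where
      open ≡-Reasoning
      agreements≡5 : length agreements ≡ 5
      agreements≡5 = trans (≤-antisym (agreements≤ within)
        (Unique-⊆⇒length≤ ps! (λ {x} m → ∈-filter⁺ agree? (∈-allPts x) (agree x m)))) len≡5

  few-agreements : ∀ {f g} p A B C → ¬ (A ≡ 0# × B ≡ 0# × C ≡ 0#) →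
                   (∀ x → f (just x) ≡ g (just x) → x ≡ p ⊎ Quadratic A B C x ≡ 0#) → FewAgreements f g
  few-agreements p A B C ≢0 finite with quadratic-roots A B C ≢0
  ... | rs , len≤2 , roots = nothing ∷ just p ∷ map just rs , s≤s (s≤s (≤-trans (≤-reflexive (length-map just rs)) len≤2)) , within
    where
    within : ∀ x → _ → x ∈ nothing ∷ just p ∷ map just rs
    within nothing  _ = here refl
    within (just x) eq with finite x eq
    ... | inj₁ refl = there (here refl)
    ... | inj₂ Qx≡0 = there (there (∈-map⁺ just (roots x Qx≡0)))

  few-agreements-affine : ∀ a b c d → ¬ (a ≡ c × b ≡ d) → FewAgreements (affine a b) (affine c d)
  -- affine maps have no pole: the point 0# only pads the list
  few-agreements-affine a b c d ≢ = few-agreements 0# 0# (a - c) (b - d)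
    (λ (_ , a-c≡0 , b-d≡0) → ≢ (x-y≡0⇒x≡y a-c≡0 , x-y≡0⇒x≡y b-d≡0))
    (λ x eq → inj₂ (trans (solve 5 (λ a b c d x → :0 :* x :* x :+ (a :- c) :* x :+ (b :- d) := a :* x :+ b :- (c :* x :+ d)) refl a b c d x)
                            (x≡y⇒x-y≡0 (just-injective eq))))

  few-agreements-affine-frac : ∀ {a} b c j s → a ≢ 0# → FewAgreements (affine a b) (frac△ c j s)
  few-agreements-affine-frac {a} b c j s a≢0 = few-agreements j a (b - c - a * j) (c * j - b * j - s)
    (λ (a≡0 , _) → a≢0 a≡0) finite
    where
    finite : ∀ x → just (a * x + b) ≡ frac△ c j s (just x) → x ≡ j ⊎ Quadratic a (b - c - a * j) (c * j - b * j - s) x ≡ 0#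
    finite x eq with x ≟ j
    ... | yes x≡j = inj₁ x≡j
    ... | no x≢j  = inj₂ (trans
      (solve 6 (λ a b c j s x → a :* x :* x :+ (b :- c :- a :* j) :* x :+ (c :* j :- b :* j :- s) := (a :* x :+ b) :* (x :- j) :- (c :* (x :- j) :+ s)) refl a b c j s x)
      (x≡y⇒x-y≡0 (y≡n/d⇒y*d≡n (x≢y⇒x-y≢0 x≢j) (trans (just-injective eq) (a+r/d≡[ad+r]/d c s (x≢y⇒x-y≢0 x≢j))))))

  cross-multiply : ∀ {a i r c j s x} → x ≢ i → x ≢ j → a + r * (x - i) ⁻¹ ≡ c + s * (x - j) ⁻¹ →
                   (a * (x - i) + r) * (x - j) ≡ (c * (x - j) + s) * (x - i)
  cross-multiply {a} {i} {r} {c} {j} {s} x≢i x≢j eq = /-cross⇒ (x≢y⇒x-y≢0 x≢i) (x≢y⇒x-y≢0 x≢j)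
    (trans (sym (a+r/d≡[ad+r]/d a r (x≢y⇒x-y≢0 x≢i))) (trans eq (a+r/d≡[ad+r]/d c s (x≢y⇒x-y≢0 x≢j))))

  private
    agree-at-both-poles : ∀ {a i r c j s} → i ≢ j → a ≡ c + s * (i - j) ⁻¹ → a + r * (j - i) ⁻¹ ≡ c → r ≡ s
    agree-at-both-poles {a} {i} {r} {c} {j} {s} i≢j at-i at-j = begin
      r                    ≡⟨ y≡n/d⇒y*d≡n (x≢y⇒x-y≢0 (λ j≡i → i≢j (sym j≡i))) (trans (sym (cong (_- a) at-j))
                                (solve 2 (λ a t → a :+ t :- a := t) refl a (r * (j - i) ⁻¹))) ⟨
      (c - a) * (j - i)    ≡⟨ solve 4 (λ a i c j → (c :- a) :* (j :- i) := (a :- c) :* (i :- j)) refl a i c j ⟩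
      (a - c) * (i - j)    ≡⟨ y≡n/d⇒y*d≡n (x≢y⇒x-y≢0 i≢j) (trans (cong (_- c) at-i)
                                (solve 2 (λ c t → c :+ t :- c := t) refl c (s * (i - j) ⁻¹))) ⟩
      s                    ∎ where open ≡-Reasoning

    cross-quadratic : ∀ a i r c j s x → x ≢ i → x ≢ j → a + r * (x - i) ⁻¹ ≡ c + s * (x - j) ⁻¹ →
                      Quadratic (a - c) (r - s - (a - c) * (i + j)) ((a - c) * i * j - r * j + s * i) x ≡ 0#
    cross-quadratic a i r c j s x x≢i x≢j eq = trans
      (solve 7 (λ a i r c j s x → (a :- c) :* x :* x :+ (r :- s :- (a :- c) :* (i :+ j)) :* x :+ ((a :- c) :* i :* j :- r :* j :+ s :* i)
                                   := (a :* (x :- i) :+ r) :* (x :- j) :- (c :* (x :- j) :+ s) :* (x :- i)) refl a i r c j s x)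
      (x≡y⇒x-y≡0 (cross-multiply x≢i x≢j eq))

    cross-quadratic≢0 : ∀ {a i r c j s C} → r ≢ s → ¬ (a - c ≡ 0# × r - s - (a - c) * (i + j) ≡ 0# × C ≡ 0#)
    cross-quadratic≢0 {a} {i} {r} {c} {j} {s} r≢s (A≡0 , B≡0 , _) = r≢s (x-y≡0⇒x≡y (begin
      r - s                                         ≡⟨ solve 6 (λ a i r c j s → r :- s := r :- s :- (a :- c) :* (i :+ j) :+ (a :- c) :* (i :+ j)) refl a i r c j s ⟩
      (r - s - (a - c) * (i + j)) + (a - c) * (i + j) ≡⟨ cong₂ (λ u v → u + v * (i + j)) B≡0 A≡0 ⟩
      0# + 0# * (i + j)                             ≡⟨ trans (+-identityˡ _) (zeroˡ (i + j)) ⟩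
      0#                                            ∎))
      where open ≡-Reasoning

  -- two fractions with distinct r agree at ∞, at no more than one of the poles i, j, and at the roots of
  -- the cross-multiplied equation (which is quadratic, even when i = j)
  few-agreements-frac : ∀ a i r c j s → r ≢ s → FewAgreements (frac△ a i r) (frac△ c j s)
  few-agreements-frac a i r c j s r≢s with frac△ a i r (just i) ≟P frac△ c j s (just i)
  ... | yes agree-at-i = few-agreements i _ _ _ (cross-quadratic≢0 r≢s) finite
    where
    finite : ∀ x → frac△ a i r (just x) ≡ frac△ c j s (just x) → x ≡ i ⊎ _
    finite x eq with x ≟ i | x ≟ j
    ... | yes x≡i | _        = inj₁ x≡i
    ... | no x≢i  | yes refl = ⊥-elim (r≢s (agree-at-both-poles (λ i≡x → x≢i (sym i≡x))
      (just-injective (trans (sym (frac△-at-pole a i r)) (trans agree-at-i (frac△-off-pole c x s (λ i≡x → x≢i (sym i≡x))))))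
      (just-injective eq)))
    ... | no x≢i  | no x≢j   = inj₂ (cross-quadratic a i r c j s x x≢i x≢j (just-injective eq))
  ... | no disagree-at-i = few-agreements j _ _ _ (cross-quadratic≢0 r≢s) finite
    where
    finite : ∀ x → frac△ a i r (just x) ≡ frac△ c j s (just x) → x ≡ j ⊎ _
    finite x eq with x ≟ i
    ... | yes refl = ⊥-elim (disagree-at-i (trans (frac△-at-pole a x r) eq))
    ... | no x≢i with x ≟ j
    ...   | yes x≡j = inj₁ x≡j
    ...   | no x≢j  = inj₂ (cross-quadratic a i r c j s x x≢i x≢j (just-injective eq))

  FewAgreements-resp : ∀ {f f′ g g′} → f ≗ f′ → g ≗ g′ → FewAgreements f′ g′ → FewAgreements f g
  FewAgreements-resp f≗f′ g≗g′ (ps , len≤4 , within) = ps , len≤4 , λ x eq → within x (trans (sym (f≗f′ x)) (trans eq (g≗g′ x)))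

  FewAgreements-sym : ∀ {f g} → FewAgreements f g → FewAgreements g f
  FewAgreements-sym (ps , len≤4 , within) = ps , len≤4 , λ x eq → within x (sym eq)

  tri-IsAffine : ∀ {π a b} → (∀ x → apply π x ≡ affine a b x) → tri (apply π) ≗ affine a b
  tri-IsAffine {a = a} {b} π≗ x = trans (tri-cong π≗ x) (tri-affine a b x)

  tri-Frac : ∀ {π a i r} → Frac r a i π → tri (apply π) ≗ frac△ a i r
  tri-Frac {a = a} {i} {r} π≗ x = trans (tri-cong π≗ x) (tri-frac a i r x)

  adjacent⇒same-P : 4 ≤ q → ∀ {π σ} → Adj π σ → ∃[ r ] (r ≢ 0# × InP r π × InP r σ)
  adjacent⇒same-P 4≤q {π} {σ} (π≉σ , hd≡q∸4) with affine-or-InP π | affine-or-InP σ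
  ... | inj₁ (a , b , _ , π≗) | inj₁ (c , d , _ , σ≗) = ⊥-elim (hd≢q∸4 _ _ 4≤q
    (FewAgreements-resp (tri-IsAffine π≗) (tri-IsAffine σ≗)
      (few-agreements-affine a b c d (λ { (refl , refl) → π≉σ (λ x → trans (π≗ x) (sym (σ≗ x))) }))) hd≡q∸4)
  ... | inj₁ (a , b , a≢0 , π≗) | inj₂ (s , _ , c , j , σ≗) = ⊥-elim (hd≢q∸4 _ _ 4≤q
    (FewAgreements-resp (tri-IsAffine π≗) (tri-Frac σ≗) (few-agreements-affine-frac b c j s a≢0)) hd≡q∸4)
  ... | inj₂ (r , _ , a , i , π≗) | inj₁ (c , d , c≢0 , σ≗) = ⊥-elim (hd≢q∸4 _ _ 4≤q
    (FewAgreements-resp (tri-Frac π≗) (tri-IsAffine σ≗) (FewAgreements-sym (few-agreements-affine-frac d a i r c≢0))) hd≡q∸4)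
  ... | inj₂ (r , r≢0 , a , i , π≗) | inj₂ (s , _ , c , j , σ≗) with r ≟ s
  ...   | yes refl = r , r≢0 , (a , i , π≗) , (c , j , σ≗)
  ...   | no r≢s   = ⊥-elim (hd≢q∸4 _ _ 4≤q
    (FewAgreements-resp (tri-Frac π≗) (tri-Frac σ≗) (few-agreements-frac a i r c j s r≢s)) hd≡q∸4)

  frac△-agree : ∀ {a i r c j s x} → x ≢ i → x ≢ j → (a * (x - i) + r) * (x - j) ≡ (c * (x - j) + s) * (x - i) →
                frac△ a i r (just x) ≡ frac△ c j s (just x)
  frac△-agree {a} {i} {r} {c} {j} {s} {x} x≢i x≢j eq = begin
    frac△ a i r (just x)                ≡⟨ frac△-off-pole a i r x≢i ⟩
    just (a + r * (x - i) ⁻¹)           ≡⟨ cong just (a+r/d≡[ad+r]/d a r (x≢y⇒x-y≢0 x≢i)) ⟩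
    just ((a * (x - i) + r) * (x - i) ⁻¹) ≡⟨ cong just (/-cross⇐ (x≢y⇒x-y≢0 x≢i) (x≢y⇒x-y≢0 x≢j) eq) ⟩
    just ((c * (x - j) + s) * (x - j) ⁻¹) ≡⟨ cong just (a+r/d≡[ad+r]/d c s (x≢y⇒x-y≢0 x≢j)) ⟨
    just (c + s * (x - j) ⁻¹)           ≡⟨ frac△-off-pole c j s x≢j ⟨
    frac△ c j s (just x)                ∎ where open ≡-Reasoning

module SixthRoot (𝔽 : FiniteField) where
  open import Data.Empty using (⊥; ⊥-elim)
  open import Data.List using (List; []; _∷_; length; filter)
  open import Data.List.Membership.Propositional using (_∈_)
  open import Data.List.Membership.Propositional.Properties using (∈-filter⁺; ∈-filter⁻)
  open import Data.List.Relation.Unary.Any as Any using (here; there)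
  open import Data.List.Relation.Unary.AllPairs using ([]; _∷_)
  open import Data.List.Relation.Unary.All using ([]; _∷_)
  import Data.List.Relation.Unary.Unique.Propositional.Properties as Unique
  open import Data.Nat as ℕ using (ℕ; zero; suc; _≤_; _%_; z≤n; s≤s)
  open import Data.Nat.DivMod using ([m+kn]%n≡m%n)
  import Data.Nat.Properties as ℕ
  open import Data.Product using (∃-syntax; _×_; _,_; proj₁)
  open import Data.Sum using (inj₁; inj₂)
  open import Relation.Binary.PropositionalEquality
  open import Relation.Nullary using (¬_; yes; no)
  open import Relation.Nullary.Decidable using (¬?; _×-dec_)

  open Field 𝔽
  open import Data.List.Membership.DecPropositional _≟_ using (_∈?_)

  -- in characteristic 3 the only root of x² - x + 1 is the double root 1/2, which has order 2
  PrimitiveSixthRoot : Carrier → Set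
  PrimitiveSixthRoot u = u * u - u + 1# ≡ 0# × u + u ≢ 1#

  module _ {u} (u²-u+1≡0 : u * u - u + 1# ≡ 0#) where
    u*[1-u]≡1 : u * (1# - u) ≡ 1#
    u*[1-u]≡1 = ≡-modulo (- 1#) u²-u+1≡0 (solve 1 (λ u → u :* (:1 :- u) := :1 :+ (:- :1) :* (u :* u :- u :+ :1)) refl u)

    u≢0 : u ≢ 0#
    u≢0 u≡0 = 1≢0 (trans (sym u*[1-u]≡1) (trans (cong (_* (1# - u)) u≡0) (zeroˡ _)))

    1-u≢0 : 1# - u ≢ 0#
    1-u≢0 1-u≡0 = 1≢0 (trans (sym u*[1-u]≡1) (trans (cong (u *_) 1-u≡0) (zeroʳ _)))

    1≢u : 1# ≢ u
    1≢u 1≡u = 1-u≢0 (x≡y⇒x-y≡0 1≡u)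

    1≢1-u : 1# ≢ 1# - u
    1≢1-u eq = u≢0 (trans (solve 1 (λ u → u := :1 :- (:1 :- u)) refl u) (x≡y⇒x-y≡0 eq))

  u≢1-u : ∀ {u} → u + u ≢ 1# → u ≢ 1# - u
  u≢1-u {u} 2u≢1 eq = 2u≢1 (trans (cong (u +_) eq) (solve 1 (λ u → u :+ (:1 :- u) := :1) refl u))

  private
    ρ : Carrier → Carrier
    ρ x = 1# - x ⁻¹

    open Orbits _≟_ ρ

    0-1 : List Carrier
    0-1 = 0# ∷ 1# ∷ []

    ∉0-1? = λ x → ¬? (x ∈? 0-1)

    domain : List Carrier
    domain = filter ∉0-1? elements

    ∈-domain⁻ : ∀ {x} → x ∈ domain → x ≢ 0# × x ≢ 1#
    ∈-domain⁻ m with ∈-filter⁻ ∉0-1? {xs = elements} m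
    ... | _ , ∉ = (λ x≡0 → ∉ (here x≡0)) , (λ x≡1 → ∉ (there (here x≡1)))

    ∈-domain⁺ : ∀ {x} → x ≢ 0# → x ≢ 1# → x ∈ domain
    ∈-domain⁺ {x} x≢0 x≢1 = ∈-filter⁺ ∉0-1? (∈-elements x) λ { (here x≡0) → x≢0 x≡0 ; (there (here x≡1)) → x≢1 x≡1 }

    q≡2+length-domain : q ≡ 2 ℕ.+ length domain
    q≡2+length-domain = trans (sym length-elements) (trans (length-filter-∁ (_∈? 0-1) elements)
      (cong (ℕ._+ length domain) (length-filter-⊆ _≟_ ((0≢1 ∷ []) ∷ [] ∷ []) elements! (λ {x} _ → ∈-elements x))))

    ρ≢0 : ∀ {x} → x ≢ 0# → x ≢ 1# → ρ x ≢ 0#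
    ρ≢0 {x} x≢0 x≢1 ρx≡0 = x≢1 (trans (sym (*-identityʳ x)) (trans (cong (x *_) (x-y≡0⇒x≡y ρx≡0)) (inverse x x≢0)))

    ρ≢1 : ∀ {x} → x ≢ 0# → ρ x ≢ 1#
    ρ≢1 {x} x≢0 ρx≡1 = ⁻¹-≢0 x≢0 (trans (solve 1 (λ e → e := :1 :- (:1 :- e)) refl (x ⁻¹))
                                    (trans (cong (λ t → 1# - t) ρx≡1) (-‿inverseʳ 1#)))

    ρ-closed : Closed domain
    ρ-closed m with ∈-domain⁻ m
    ... | x≢0 , x≢1 = ∈-domain⁺ (ρ≢0 x≢0 x≢1) (ρ≢1 x≢0)

    -- ρ x = (x - 1)/x and ρ (ρ x) = 1/(1 - x)
    ρ-order3 : Order3On domain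
    ρ-order3 {x} m with ∈-domain⁻ m
    ... | x≢0 , x≢1 = trans (cong (λ t → 1# - t) ρ²x⁻¹≡1-x) (solve 1 (λ x → :1 :- (:1 :- x) := x) refl x)
      where
      y = ρ x
      y≢0 = ρ≢0 x≢0 x≢1
      z = ρ y
      z≢0 = ρ≢0 y≢0 (ρ≢1 x≢0)
      [1-x]*z≡1 : (1# - x) * z ≡ 1#
      [1-x]*z≡1 = ≡-modulo x (x*x⁻¹-1≡0 y≢0) (≡-modulo (y ⁻¹) (x*x⁻¹-1≡0 x≢0)
        (solve 3 (λ x e f → (:1 :- x) :* (:1 :- f) := :1 :+ x :* ((:1 :- e) :* f :- :1) :+ f :* (x :* e :- :1)) refl x (x ⁻¹) (y ⁻¹)))
      ρ²x⁻¹≡1-x : z ⁻¹ ≡ 1# - x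
      ρ²x⁻¹≡1-x = *-cancelʳ z≢0 (trans (x⁻¹*x≡1 z≢0) (sym [1-x]*z≡1))

    fixed⇒root : ∀ {x} → x ≢ 0# → ρ x ≡ x → x * x - x + 1# ≡ 0#
    fixed⇒root {x} x≢0 ρx≡x = ≡-modulo x (x≡y⇒x-y≡0 (sym ρx≡x)) (≡-modulo (- 1#) (x*x⁻¹-1≡0 x≢0)
      (solve 2 (λ x e → x :* x :- x :+ :1 := :0 :+ x :* (x :- (:1 :- e)) :+ (:- :1) :* (x :* e :- :1)) refl x (x ⁻¹)))

    half-unique : ∀ {y z} → y + y ≡ 1# → z + z ≡ 1# → y ≡ z
    half-unique {y} {z} 2y≡1 2z≡1 with x*y≡0⇒x≡0⊎y≡0 (trans
      (solve 2 (λ y z → (:1 :+ :1) :* (y :- z) := y :+ y :- (z :+ z)) refl y z) (x≡y⇒x-y≡0 (trans 2y≡1 (sym 2z≡1))))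
    ... | inj₂ y-z≡0 = x-y≡0⇒x≡y y-z≡0
    ... | inj₁ 2≡0   = ⊥-elim (0≢1 (trans (sym (trans (solve 1 (λ y → y :+ y := (:1 :+ :1) :* y) refl y)
                                                    (trans (cong (_* y) 2≡0) (zeroˡ y)))) 2y≡1))

    domain! = Unique.filter⁺ ∉0-1? elements!

    fixedPoints≡2-mod-3 : q % 3 ≡ 1 → (2 ℕ.+ length (fixedPoints domain)) % 3 ≡ 1
    fixedPoints≡2-mod-3 q%3≡1 with length≡3k+fixedPoints domain domain! ρ-closed ρ-order3
    ... | k , length≡ = begin
      (2 ℕ.+ f) % 3              ≡⟨ [m+kn]%n≡m%n (2 ℕ.+ f) k 3 ⟨
      (2 ℕ.+ f ℕ.+ k ℕ.* 3) % 3  ≡⟨ cong (_% 3) q≡2+f+3k ⟨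
      q % 3                      ≡⟨ q%3≡1 ⟩
      1                          ∎
      where
      open ≡-Reasoning
      f = length (fixedPoints domain)
      q≡2+f+3k : q ≡ 2 ℕ.+ f ℕ.+ k ℕ.* 3
      q≡2+f+3k = trans q≡2+length-domain (trans (cong (2 ℕ.+_) (trans length≡ (ℕ.+-comm (k ℕ.* 3) f)))
                   (sym (ℕ.+-assoc 2 f (k ℕ.* 3))))

    ≤1-fixedPoints : (∀ u → ¬ PrimitiveSixthRoot u) → length (fixedPoints domain) ≤ 1
    ≤1-fixedPoints none with fixedPoints domain in eq
    ... | []    = z≤n
    ... | y ∷ _ = subst (λ ys → length ys ≤ 1) eq (Unique-⊆⇒length≤ {ys = y ∷ []} (Unique.filter⁺ Fixed? {domain} domain!)
                    (λ m → here (half-unique (fixed⇒half m) (fixed⇒half (subst (y ∈_) (sym eq) (here refl))))))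
      where
      fixed⇒half : ∀ {x} → x ∈ fixedPoints domain → x + x ≡ 1#
      fixed⇒half {x} m with ∈-filter⁻ Fixed? {xs = domain} m | (x + x) ≟ 1#
      ... | _ , _      | yes 2x≡1 = 2x≡1
      ... | x∈ , fixed | no 2x≢1  = ⊥-elim (none x (fixed⇒root (proj₁ (∈-domain⁻ x∈)) fixed , 2x≢1))

  primitiveSixthRoot : q % 3 ≡ 1 → ∃[ u ] PrimitiveSixthRoot u
  primitiveSixthRoot q%3≡1 with Any.any? (λ x → ((x * x - x + 1#) ≟ 0#) ×-dec ¬? ((x + x) ≟ 1#)) elements
  ... | yes found = Any.satisfied found
  ... | no none = ⊥-elim (impossible _ (≤1-fixedPoints (λ u root → none (Any.map (λ { refl → root }) (∈-elements u))))
                                     (fixedPoints≡2-mod-3 q%3≡1))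
    where
    impossible : ∀ f → f ≤ 1 → (2 ℕ.+ f) % 3 ≡ 1 → ⊥
    impossible zero          _         ()
    impossible (suc zero)    _         ()
    impossible (suc (suc _)) (s≤s ()) _

module Edges (𝔽 : FiniteField) where
  open import Data.Empty using (⊥-elim)
  open import Data.List using (List; []; _∷_)
  open import Data.List.Membership.Propositional using (_∈_)
  open import Data.List.Relation.Unary.All using ([]; _∷_)
  open import Data.List.Relation.Unary.AllPairs using ([]; _∷_)
  open import Data.List.Relation.Unary.Any using (here; there)
  open import Data.List.Relation.Unary.Unique.Propositional using (Unique)
  open import Data.Maybe using (just; nothing)
  open import Data.Maybe.Properties using (just-injective)
  open import Data.Nat using (_∸_)
  open import Data.Sum using (_⊎_; inj₁; inj₂)
  open import Relation.Binary.PropositionalEquality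
  open import Relation.Nullary using (yes; no)

  open Field 𝔽
  open Contraction 𝔽
  open SixthRoot 𝔽 using (u*[1-u]≡1; u≢0; 1-u≢0; 1≢u; 1≢1-u; u≢1-u)

  edge-identity : ∀ a α β i u x →
    ((a + α) * (x - (i + β)) + α * β) * (x - i) - (a * (x - i) + α * β) * (x - (i + β))
      ≡ α * ((x - i - β * u) * (x - i - β * (1# - u))) + α * β * β * (u * u - u + 1#)
  edge-identity = solve 6 (λ a α β i u x →
    ((a :+ α) :* (x :- (i :+ β)) :+ α :* β) :* (x :- i) :- (a :* (x :- i) :+ α :* β) :* (x :- (i :+ β))
      := α :* ((x :- i :- β :* u) :* (x :- i :- β :* (:1 :- u))) :+ α :* β :* β :* (u :* u :- u :+ :1)) refl

  module _ {u} (u²-u+1≡0 : u * u - u + 1# ≡ 0#) (2u≢1 : u + u ≢ 1#) (a i α β : Carrier) (α≢0 : α ≢ 0#) (β≢0 : β ≢ 0#) where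
    private
      r = α * β
      F = frac△ a i r
      G = frac△ (a + α) (i + β) r

      β≢βu = *-cancelˡ-≢ {β} {1#} {u} β≢0 (1≢u u²-u+1≡0)
      β≢β[1-u] = *-cancelˡ-≢ {β} {1#} {1# - u} β≢0 (1≢1-u u²-u+1≡0)

      i≢i+β : i ≢ i + β
      i≢i+β = x≢x+t β≢0
      i≢i+βu : i ≢ i + β * u
      i≢i+βu = x≢x+t (*-≢0 β≢0 (u≢0 u²-u+1≡0))
      i≢i+β[1-u] : i ≢ i + β * (1# - u)
      i≢i+β[1-u] = x≢x+t (*-≢0 β≢0 (1-u≢0 u²-u+1≡0))
      i+β≢i+βu : i + β ≢ i + β * u
      i+β≢i+βu = x+s≢x+t (λ β≡βu → β≢βu (trans (*-identityʳ β) β≡βu))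
      i+β≢i+β[1-u] : i + β ≢ i + β * (1# - u)
      i+β≢i+β[1-u] = x+s≢x+t (λ β≡β[1-u] → β≢β[1-u] (trans (*-identityʳ β) β≡β[1-u]))
      i+βu≢i+β[1-u] : i + β * u ≢ i + β * (1# - u)
      i+βu≢i+β[1-u] = x+s≢x+t (*-cancelˡ-≢ β≢0 (u≢1-u 2u≢1))

      agreements : List Pt
      agreements = nothing ∷ just i ∷ just (i + β) ∷ just (i + β * u) ∷ just (i + β * (1# - u)) ∷ []

      agreements! : Unique agreements
      agreements! = ((λ ()) ∷ (λ ()) ∷ (λ ()) ∷ (λ ()) ∷ [])
                  ∷ (≢just i≢i+β ∷ ≢just i≢i+βu ∷ ≢just i≢i+β[1-u] ∷ [])
                  ∷ (≢just i+β≢i+βu ∷ ≢just i+β≢i+β[1-u] ∷ [])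
                  ∷ (≢just i+βu≢i+β[1-u] ∷ [])
                  ∷ [] ∷ []
        where
        ≢just : ∀ {x y} → x ≢ y → just x ≢ just y
        ≢just x≢y eq = x≢y (just-injective eq)

      cross-difference : Carrier → Carrier
      cross-difference x = ((a + α) * (x - (i + β)) + r) * (x - i) - (a * (x - i) + r) * (x - (i + β))

      cross-difference≡ : ∀ x → cross-difference x ≡ α * ((x - i - β * u) * (x - i - β * (1# - u)))
      cross-difference≡ x = ≡-modulo (α * β * β) u²-u+1≡0 (edge-identity a α β i u x)

      roots≡0 : ∀ {x} → cross-difference x ≡ 0# → α * ((x - i - β * u) * (x - i - β * (1# - u))) ≡ 0#
      roots≡0 {x} eq = trans (sym (cross-difference≡ x)) eq

      cross-difference≡0 : ∀ {x} → (x - i - β * u) * (x - i - β * (1# - u)) ≡ 0# → cross-difference x ≡ 0#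
      cross-difference≡0 {x} eq = trans (cross-difference≡ x) (trans (cong (α *_) eq) (zeroʳ α))

      agree : ∀ x → x ∈ agreements → F x ≡ G x
      agree _ (here refl) = refl
      agree _ (there (here refl)) = trans (frac△-at-pole a i r) (sym (trans (frac△-off-pole (a + α) (i + β) r i≢i+β)
        (cong just (trans (a+r/d≡[ad+r]/d (a + α) r (x≢y⇒x-y≢0 i≢i+β)) (n≡y*d⇒n/d≡y (x≢y⇒x-y≢0 i≢i+β)
          (solve 4 (λ a α β i → (a :+ α) :* (i :- (i :+ β)) :+ α :* β := a :* (i :- (i :+ β))) refl a α β i))))))
      agree _ (there (there (here refl))) = trans (frac△-off-pole a i r (≢-sym i≢i+β))
        (trans (cong just (trans (a+r/d≡[ad+r]/d a r (x≢y⇒x-y≢0 (≢-sym i≢i+β))) (n≡y*d⇒n/d≡y (x≢y⇒x-y≢0 (≢-sym i≢i+β))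
          (solve 4 (λ a α β i → a :* (i :+ β :- i) :+ α :* β := (a :+ α) :* (i :+ β :- i)) refl a α β i))))
          (sym (frac△-at-pole (a + α) (i + β) r)))
      agree _ (there (there (there (here refl)))) =
        frac△-agree (≢-sym i≢i+βu) (≢-sym i+β≢i+βu) (sym (x-y≡0⇒x≡y (cross-difference≡0
          (trans (cong (_* (i + β * u - i - β * (1# - u))) (x+y-x-y≡0 i (β * u))) (zeroˡ _)))))
      agree _ (there (there (there (there (here refl))))) =
        frac△-agree (≢-sym i≢i+β[1-u]) (≢-sym i+β≢i+β[1-u]) (sym (x-y≡0⇒x≡y (cross-difference≡0
          (trans (cong ((i + β * (1# - u) - i - β * u) *_) (x+y-x-y≡0 i (β * (1# - u)))) (zeroʳ _)))))

      off-poles : ∀ {x} → x ≢ i → x ≢ i + β → a + r * (x - i) ⁻¹ ≡ (a + α) + r * (x - (i + β)) ⁻¹ → just x ∈ agreements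
      off-poles {x} x≢i x≢i+β eq = root (x*y≡0⇒x≡0⊎y≡0 (roots≡0 difference≡0))
        where
        crossed : (a * (x - i) + r) * (x - (i + β)) ≡ ((a + α) * (x - (i + β)) + r) * (x - i)
        crossed = cross-multiply x≢i x≢i+β eq
        difference≡0 : cross-difference x ≡ 0#
        difference≡0 = x≡y⇒x-y≡0 (sym crossed)
        root : α ≡ 0# ⊎ (x - i - β * u) * (x - i - β * (1# - u)) ≡ 0# → just x ∈ agreements
        root (inj₁ α≡0) = ⊥-elim (α≢0 α≡0)
        root (inj₂ roots≡0) with x*y≡0⇒x≡0⊎y≡0 roots≡0
        ... | inj₁ x-i-βu≡0      = there (there (there (here (cong just (x-y-z≡0⇒x≡y+z x-i-βu≡0)))))
        ... | inj₂ x-i-β[1-u]≡0 = there (there (there (there (here (cong just (x-y-z≡0⇒x≡y+z x-i-β[1-u]≡0))))))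

      agreements-within : AgreementsIn F G agreements
      agreements-within nothing _ = here refl
      agreements-within (just x) eq with x ≟ i
      ... | yes refl = there (here refl)
      ... | no x≢i with x ≟ (i + β)
      ...   | yes refl = there (there (here refl))
      ...   | no x≢i+β = off-poles x≢i x≢i+β (just-injective eq)

    hd-edge : ∀ {f g} → f ≗ F → g ≗ G → hd f g ≡ q ∸ 4
    hd-edge {f} {g} f≗F g≗G = hd≡q∸4 f g agreements agreements! refl
      (λ x eq → agreements-within x (trans (sym (f≗F x)) (trans eq (g≗G x))))
      (λ x m → trans (f≗F x) (trans (agree x m) (sym (g≗G x))))

module Components (𝔽 : FiniteField) where
  open import Data.Empty using (⊥-elim)
  open import Data.List using ([]; _∷_)
  open import Data.List.Relation.Unary.Any using (here; there)
  open import Data.Maybe using (just; nothing)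
  open import Data.Maybe.Properties using (just-injective)
  open import Data.Nat as ℕ using (_≤_; _∸_)
  open import Data.Nat.Properties using (≤-trans; n≤1+n)
  open import Data.Product using (Σ; ∃-syntax; _×_; _,_; proj₁; proj₂)
  open import Data.Sum using (_⊎_; inj₁; inj₂)
  open import Data.Unit using (tt)
  open import Function.Bundles using (_⇔_; mk⇔; Equivalence; Inverse)
  open import Data.Fin using (Fin; combine; remQuot)
  open import Data.Fin.Properties using (combine-remQuot; remQuot-combine)
  open import Relation.Binary.PropositionalEquality
  open import Relation.Nullary using (¬_; yes; no)

  open Field 𝔽
  open Contraction 𝔽
  open Edges 𝔽

  opaque
    fracPGL-nondegenerate : ∀ a i {r} → r ≢ 0# → a * (- i) ≢ (r - a * i) * 1#
    fracPGL-nondegenerate a i {r} r≢0 eq = r≢0 (x-y≡0⇒x≡y (trans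
      (solve 3 (λ a i r → r :- :0 := (r :- a :* i) :* :1 :- a :* (:- i)) refl a i r) (x≡y⇒x-y≡0 (sym eq))))

  fracPGL : ∀ a i {r} → r ≢ 0# → PGL
  fracPGL a i {r} r≢0 = mat a (r - a * i) 1# (- i) (fracPGL-nondegenerate a i r≢0)

  Frac-fracPGL : ∀ a i {r} (r≢0 : r ≢ 0#) → Frac r a i (fracPGL a i r≢0)
  Frac-fracPGL a i {r} r≢0 nothing with 1# ≟ 0#
  ... | yes 1≡0 = ⊥-elim (1≢0 1≡0)
  ... | no _    = cong just (trans (cong (a *_) 1⁻¹≡1) (*-identityʳ a))
  Frac-fracPGL a i {r} r≢0 (just x) with (1# * x + (- i)) ≟ 0# | x ≟ i
  ... | yes _       | yes _   = refl
  ... | yes x-i≡0   | no x≢i  = ⊥-elim (x≢i (x-y≡0⇒x≡y (trans (cong (_+ (- i)) (sym (*-identityˡ x))) x-i≡0)))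
  ... | no x-x≢0    | yes refl = ⊥-elim (x-x≢0 (trans (cong (_+ (- x)) (*-identityˡ x)) (-‿inverseʳ x)))
  ... | no _        | no x≢i  = cong just (begin
    (a * x + (r - a * i)) * (1# * x + (- i)) ⁻¹   ≡⟨ cong (λ t → (a * x + (r - a * i)) * (t + (- i)) ⁻¹) (*-identityˡ x) ⟩
    (a * x + (r - a * i)) * (x - i) ⁻¹            ≡⟨ cong (_* (x - i) ⁻¹) (solve 4 (λ a x r i → a :* x :+ (r :- a :* i) := a :* (x :- i) :+ r) refl a x r i) ⟩
    (a * (x - i) + r) * (x - i) ⁻¹                ≡⟨ a+r/d≡[ad+r]/d a r (x≢y⇒x-y≢0 x≢i) ⟨
    a + r * (x - i) ⁻¹                            ∎)
    where open ≡-Reasoning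

  affinePGL : ∀ {a} b → a ≢ 0# → PGL
  affinePGL {a} b a≢0 = mat a b 0# 1# (λ eq → a≢0 (trans (sym (*-identityʳ a)) (trans eq (zeroʳ b))))

  affinePGL-affine : ∀ {a} b (a≢0 : a ≢ 0#) x → apply (affinePGL b a≢0) x ≡ affine a b x
  affinePGL-affine b a≢0 nothing with 0# ≟ 0#
  ... | yes _   = refl
  ... | no 0≢0  = ⊥-elim (0≢0 refl)
  affinePGL-affine {a} b a≢0 (just x) with (0# * x + 1#) ≟ 0#
  ... | yes 0x+1≡0 = ⊥-elim (1≢0 (trans (sym 0x+1≡1) 0x+1≡0))
    where 0x+1≡1 = trans (cong (_+ 1#) (zeroˡ x)) (+-identityˡ 1#)
  ... | no _       = cong just (trans (cong (λ t → (a * x + b) * t ⁻¹) (trans (cong (_+ 1#) (zeroˡ x)) (+-identityˡ 1#)))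
                     (trans (cong ((a * x + b) *_) 1⁻¹≡1) (*-identityʳ _)))

  P-disjoint : ∀ r s → r ≢ s → ∀ π → InP r π → ¬ InP s π
  P-disjoint r s r≢s π (a , i , π≗r) (c , j , π≗s) with i ≟ j
  ... | no i≢j  with trans (sym (frac-at-pole a i r)) (trans (sym (π≗r (just i))) (trans (π≗s (just i)) (frac-off-pole c j s i≢j)))
  ...   | ()
  P-disjoint r s r≢s π (a , i , π≗r) (c , j , π≗s) | yes refl =
    r≢s (*-cancelʳ (⁻¹-≢0 (x≢y⇒x-y≢0 i+1≢i)) (+-cancelˡ a (r * (i + 1# - i) ⁻¹) (s * (i + 1# - i) ⁻¹) (just-injective (begin
      just (a + r * (i + 1# - i) ⁻¹)  ≡⟨ frac-off-pole a i r i+1≢i ⟨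
      frac a i r (just (i + 1#))      ≡⟨ trans (sym (π≗r (just (i + 1#)))) (π≗s (just (i + 1#))) ⟩
      frac c i s (just (i + 1#))      ≡⟨ frac-off-pole c i s i+1≢i ⟩
      just (c + s * (i + 1# - i) ⁻¹)  ≡⟨ cong (λ t → just (t + s * (i + 1# - i) ⁻¹)) a≡c ⟨
      just (a + s * (i + 1# - i) ⁻¹)  ∎))))
    where
    open ≡-Reasoning
    i+1≢i : i + 1# ≢ i
    i+1≢i eq = x≢x+t 1≢0 (sym eq)
    a≡c : a ≡ c
    a≡c = just-injective (trans (sym (π≗r nothing)) (π≗s nothing))

  ZeroSumShifts : Carrier → Carrier → Set
  ZeroSumShifts r z = ∃[ β₁ ] ∃[ β₂ ] ∃[ β₃ ]
    ((β₁ ≢ 0# × β₂ ≢ 0# × β₃ ≢ 0#) × β₁ + β₂ + β₃ ≡ 0# × r * β₁ ⁻¹ + r * β₂ ⁻¹ + r * β₃ ⁻¹ ≡ z)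

  -- the pole shifts β, tβ, -(1 + t)β sum to zero, while the value shifts add up to (r/β)(1 + 1/t - 1/(1 + t)),
  -- which is nonzero and so can be made any z ≠ 0 by the choice of β
  zero-sum-shifts : ∀ {r z t} → r ≢ 0# → z ≢ 0# → t ≢ 0# → 1# + t ≢ 0# → t * t + t + 1# ≢ 0# → ZeroSumShifts r z
  zero-sum-shifts {r} {z} {t} r≢0 z≢0 t≢0 1+t≢0 t²+t+1≢0 =
    β , t * β , - ((1# + t) * β) , (β≢0 , *-≢0 t≢0 β≢0 , -‿≢0 (*-≢0 1+t≢0 β≢0)) , poles , values
    where
    K = 1# + t ⁻¹ - (1# + t) ⁻¹
    K*t*[1+t]≡t²+t+1 : K * (t * (1# + t)) ≡ t * t + t + 1#
    K*t*[1+t]≡t²+t+1 = ≡-modulo (- t) (x*x⁻¹-1≡0 1+t≢0) (≡-modulo (1# + t) (x*x⁻¹-1≡0 t≢0)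
      (solve 3 (λ t e f → (:1 :+ e :- f) :* (t :* (:1 :+ t)) := t :* t :+ t :+ :1 :+ (:- t) :* ((:1 :+ t) :* f :- :1) :+ (:1 :+ t) :* (t :* e :- :1)) refl t (t ⁻¹) ((1# + t) ⁻¹)))
    K≢0 : K ≢ 0#
    K≢0 K≡0 = t²+t+1≢0 (trans (sym K*t*[1+t]≡t²+t+1) (trans (cong (_* (t * (1# + t))) K≡0) (zeroˡ _)))
    β = r * K * z ⁻¹
    β≢0 : β ≢ 0#
    β≢0 = *-≢0 (*-≢0 r≢0 K≢0) (⁻¹-≢0 z≢0)
    z*β≡r*K : z * β ≡ r * K
    z*β≡r*K = trans (solve 3 (λ z n e → z :* (n :* e) := n :* e :* z) refl z (r * K) (z ⁻¹)) ([y*x⁻¹]*x≡y (r * K) z≢0)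
    poles : β + t * β + - ((1# + t) * β) ≡ 0#
    poles = solve 2 (λ β t → β :+ t :* β :+ :- ((:1 :+ t) :* β) := :0) refl β t
    values : r * β ⁻¹ + r * (t * β) ⁻¹ + r * (- ((1# + t) * β)) ⁻¹ ≡ z
    values = begin
      r * β ⁻¹ + r * (t * β) ⁻¹ + r * (- ((1# + t) * β)) ⁻¹
        ≡⟨ cong₂ (λ x y → r * β ⁻¹ + r * x + r * y) (⁻¹-distrib-* t≢0 β≢0)
              (trans (⁻¹-distrib-neg (*-≢0 1+t≢0 β≢0)) (cong -_ (⁻¹-distrib-* 1+t≢0 β≢0))) ⟩
      r * β ⁻¹ + r * (t ⁻¹ * β ⁻¹) + r * - ((1# + t) ⁻¹ * β ⁻¹)
        ≡⟨ solve 4 (λ r e f B → r :* B :+ r :* (e :* B) :+ r :* (:- (f :* B)) := r :* (:1 :+ e :- f) :* B) refl r (t ⁻¹) ((1# + t) ⁻¹) (β ⁻¹) ⟩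
      r * K * β ⁻¹
        ≡⟨ n≡y*d⇒n/d≡y β≢0 (sym z*β≡r*K) ⟩
      z ∎
      where open ≡-Reasoning

  module WithSixthRoot {u} (u²-u+1≡0 : u * u - u + 1# ≡ 0#) (2u≢1 : u + u ≢ 1#) (5≤q : 5 ≤ q) where
    4≤q : 4 ≤ q
    4≤q = ≤-trans (n≤1+n 4) 5≤q

    -- x² + x + 1 = (x + u)(x + 1 - u) has at most two roots, so with 0 and -1 at most four values are excluded
    opaque
      ∃-ratio : ∃[ t ] (t ≢ 0# × 1# + t ≢ 0# × t * t + t + 1# ≢ 0#)
      ∃-ratio with ∃-∉ (0# ∷ - 1# ∷ - u ∷ - (1# - u) ∷ []) 5≤q
      ... | t , t∉ = t , (λ t≡0 → t∉ (here t≡0)) , (λ 1+t≡0 → t∉ (there (here (t≡-1 1+t≡0)))) , t²+t+1≢0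
        where
        t≡-1 : 1# + t ≡ 0# → t ≡ - 1#
        t≡-1 eq = x-y≡0⇒x≡y (trans (solve 1 (λ t → t :- :- :1 := :1 :+ t) refl t) eq)
        t²+t+1≡[t+u][t+1-u] : t * t + t + 1# ≡ (t + u) * (t + (1# - u))
        t²+t+1≡[t+u][t+1-u] = ≡-modulo 1# u²-u+1≡0
          (solve 2 (λ t u → t :* t :+ t :+ :1 := (t :+ u) :* (t :+ (:1 :- u)) :+ :1 :* (u :* u :- u :+ :1)) refl t u)
        t+s≡0⇒t≡-s : ∀ s → t + s ≡ 0# → t ≡ - s
        t+s≡0⇒t≡-s s eq = x-y≡0⇒x≡y (trans (solve 2 (λ t s → t :- :- s := t :+ s) refl t s) eq)
        t²+t+1≢0 : t * t + t + 1# ≢ 0#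
        t²+t+1≢0 eq with x*y≡0⇒x≡0⊎y≡0 (trans (sym t²+t+1≡[t+u][t+1-u]) eq)
        ... | inj₁ t+u≡0   = t∉ (there (there (here (t+s≡0⇒t≡-s u t+u≡0))))
        ... | inj₂ t+1-u≡0 = t∉ (there (there (there (here (t+s≡0⇒t≡-s (1# - u) t+1-u≡0)))))

    module _ {r} (r≢0 : r ≢ 0#) where
      adjacent-step : ∀ {a i β π σ} → β ≢ 0# → Frac r a i π → Frac r (a + r * β ⁻¹) (i + β) σ → Adj π σ
      adjacent-step {a} {i} {β} {π} {σ} β≢0 π≗ σ≗ =
        (λ π≈σ → x≢x+t α≢0 (just-injective (trans (sym (π≗ nothing)) (trans (π≈σ nothing) (σ≗ nothing))))) ,
        hd-edge u²-u+1≡0 2u≢1 a i α β α≢0 β≢0 (tri-Frac (as-αβ π≗)) (tri-Frac (as-αβ σ≗))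
        where
        α = r * β ⁻¹
        α≢0 : α ≢ 0#
        α≢0 = *-≢0 r≢0 (⁻¹-≢0 β≢0)
        as-αβ : ∀ {a i ρ} → Frac r a i ρ → Frac (α * β) a i ρ
        as-αβ = subst (λ s → Frac s _ _ _) (sym ([y*x⁻¹]*x≡y r β≢0))

      path-step : ∀ {a i β π σ τ} → β ≢ 0# → Frac r a i π → Frac r (a + r * β ⁻¹) (i + β) σ →
                  PathIn (InP r) σ τ → PathIn (InP r) π τ
      path-step β≢0 π≗ σ≗ = step (_ , _ , π≗) (adjacent-step β≢0 π≗ σ≗)

      horizontal-path : ∀ {a c i π σ} → Frac r a i π → Frac r c i σ → PathIn (InP r) π σ
      horizontal-path {a} {c} {i} {π} {σ} π≗ σ≗ with (c - a) ≟ 0#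
      ... | yes c-a≡0 = here (a , i , π≗) (λ x → trans (π≗ x) (trans (cong (λ t → frac t i r x) (sym (x-y≡0⇒x≡y c-a≡0))) (sym (σ≗ x))))
      ... | no c-a≢0 = three-steps (zero-sum-shifts r≢0 c-a≢0 (proj₁ (proj₂ ∃-ratio)) (proj₁ (proj₂ (proj₂ ∃-ratio))) (proj₂ (proj₂ (proj₂ ∃-ratio))))
        where
        three-steps : ZeroSumShifts r (c - a) → PathIn (InP r) π σ
        three-steps (β₁ , β₂ , β₃ , (β₁≢0 , β₂≢0 , β₃≢0) , poles , values) =
          path-step β₁≢0 π≗ (Frac-fracPGL _ _ r≢0) (path-step β₂≢0 (Frac-fracPGL _ _ r≢0) (Frac-fracPGL _ _ r≢0)
            (path-step β₃≢0 (Frac-fracPGL _ _ r≢0) σ≗′ (here (_ , _ , σ≗′) (λ _ → refl))))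
          where
          σ≗′ : Frac r (a + r * β₁ ⁻¹ + r * β₂ ⁻¹ + r * β₃ ⁻¹) (i + β₁ + β₂ + β₃) σ
          σ≗′ = subst₂ (λ c′ i′ → Frac r c′ i′ σ)
            (trans (solve 2 (λ a c → c := a :+ (c :- a)) refl a c) (trans (cong (a +_) (sym values))
              (solve 4 (λ a x y w → a :+ (x :+ y :+ w) := a :+ x :+ y :+ w) refl a (r * β₁ ⁻¹) (r * β₂ ⁻¹) (r * β₃ ⁻¹))))
            (trans (sym (+-identityʳ i)) (trans (cong (i +_) (sym poles))
              (solve 4 (λ i x y w → i :+ (x :+ y :+ w) := i :+ x :+ y :+ w) refl i β₁ β₂ β₃)))
            σ≗

      path : ∀ {a i c j π σ} → Frac r a i π → Frac r c j σ → PathIn (InP r) π σ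
      path {a} {i} {c} {j} {σ = σ} π≗ σ≗ with (j - i) ≟ 0#
      ... | yes j-i≡0 = horizontal-path π≗ (subst (λ j′ → Frac r c j′ σ) (x-y≡0⇒x≡y j-i≡0) σ≗)
      ... | no j-i≢0  = path-step j-i≢0 π≗ (Frac-fracPGL _ _ r≢0)
        (horizontal-path (Frac-fracPGL _ _ r≢0) (subst (λ j′ → Frac r c j′ σ) (solve 2 (λ i j → j := i :+ (j :- i)) refl i j) σ≗))

    P-connected : ∀ r → r ≢ 0# → ∀ π σ → InP r π → InP r σ → PathIn (InP r) π σ
    P-connected r r≢0 π σ (_ , _ , π≗) (_ , _ , σ≗) = path r≢0 π≗ σ≗

    isolated⇔affine : ∀ π → Isolated π ⇔ IsAffine π
    isolated⇔affine π = mk⇔ isolated⇒affine affine⇒isolated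
      where
      affine⇒isolated : IsAffine π → Isolated π
      affine⇒isolated π-affine σ π~σ = affine∉P π-affine (proj₁ (proj₂ (proj₂ (adjacent⇒same-P 4≤q π~σ))))
      isolated⇒affine : Isolated π → IsAffine π
      isolated⇒affine π-isolated with affine-or-InP π
      ... | inj₁ π-affine = π-affine
      ... | inj₂ (r , r≢0 , a , i , π≗) =
        ⊥-elim (π-isolated (fracPGL (a + r * 1# ⁻¹) (i + 1#) r≢0) (adjacent-step r≢0 1≢0 π≗ (Frac-fracPGL _ _ r≢0)))

    InP-resp-≈ : ∀ {r π σ} → InP r π → π ≈ σ → InP r σ
    InP-resp-≈ (a , i , π≗) π≈σ = a , i , λ x → trans (sym (π≈σ x)) (π≗ x)

    path⇒same-P : ∀ {π σ} → PathIn Everything π σ → π ≈ σ ⊎ ∃[ r ] (r ≢ 0# × InP r π × InP r σ)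
    path⇒same-P (here _ π≈σ) = inj₁ π≈σ
    path⇒same-P (step _ π~ρ ρ⋯σ) with adjacent⇒same-P 4≤q π~ρ | path⇒same-P ρ⋯σ
    ... | r , r≢0 , π∈ , ρ∈ | inj₁ ρ≈σ = inj₂ (r , r≢0 , π∈ , InP-resp-≈ ρ∈ ρ≈σ)
    ... | r , r≢0 , π∈ , ρ∈ | inj₂ (s , _ , ρ∈′ , σ∈) with r ≟ s
    ...   | yes refl = inj₂ (r , r≢0 , π∈ , σ∈)
    ...   | no r≢s   = ⊥-elim (P-disjoint r s r≢s _ ρ∈ ρ∈′)

    PathIn⇒Everything : ∀ {S π σ} → PathIn S π σ → PathIn Everything π σ
    PathIn⇒Everything (here _ π≈σ)    = here tt π≈σ
    PathIn⇒Everything (step _ π~ρ ρ⋯σ) = step tt π~ρ (PathIn⇒Everything ρ⋯σ)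

    components : ∀ π σ → PathIn Everything π σ ⇔ (π ≈ σ ⊎ ∃[ r ] (r ≢ 0# × InP r π × InP r σ))
    components π σ = mk⇔ path⇒same-P same-P⇒path
      where
      same-P⇒path : π ≈ σ ⊎ ∃[ r ] (r ≢ 0# × InP r π × InP r σ) → PathIn Everything π σ
      same-P⇒path (inj₁ π≈σ) = here tt π≈σ
      same-P⇒path (inj₂ (r , r≢0 , π∈ , σ∈)) = PathIn⇒Everything (P-connected r r≢0 π σ π∈ σ∈)

    private
      to : Carrier → Fin q
      to = Inverse.to enum
      from : Fin q → Carrier
      from = Inverse.from enum

      nonzero : Fin (q ∸ 1) → Carrier
      nonzero k = from (punchIn′ (to 0#) k)

      nonzero≢0 : ∀ k → nonzero k ≢ 0#
      nonzero≢0 k eq = punchIn′ᵢ≢i (to 0#) k (trans (sym (Inverse.strictlyInverseˡ enum _)) (cong to eq))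

      affine-at : Fin q × Fin (q ∸ 1) → Σ PGL Isolated
      affine-at (b , a) = affinePGL (from b) (nonzero≢0 a) ,
        Equivalence.from (isolated⇔affine _) (nonzero a , from b , nonzero≢0 a , affinePGL-affine (from b) (nonzero≢0 a))

    isolated-vertices : Fin (q ℕ.* (q ∸ 1)) → Σ PGL Isolated
    isolated-vertices k = affine-at (remQuot (q ∸ 1) k)

    isolated-vertices-injective : ∀ k l → proj₁ (isolated-vertices k) ≈ proj₁ (isolated-vertices l) → k ≡ l
    isolated-vertices-injective k l k≈l = begin
      k                                ≡⟨ combine-remQuot {q} (q ∸ 1) k ⟨
      combine (proj₁ kk) (proj₂ kk)    ≡⟨ cong₂ combine (from-injective b≡b′) (punchIn′-injective (to 0#) (from-injective a≡a′)) ⟩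
      combine (proj₁ ll) (proj₂ ll)    ≡⟨ combine-remQuot {q} (q ∸ 1) l ⟩
      l                                ∎
      where
      open ≡-Reasoning
      kk = remQuot {q} (q ∸ 1) k
      ll = remQuot {q} (q ∸ 1) l
      a = nonzero (proj₂ kk)
      b = from (proj₁ kk)
      a′ = nonzero (proj₂ ll)
      b′ = from (proj₁ ll)
      values : ∀ x → a * x + b ≡ a′ * x + b′
      values x = just-injective (trans (sym (affinePGL-affine b (nonzero≢0 _) (just x)))
                   (trans (k≈l (just x)) (affinePGL-affine b′ (nonzero≢0 _) (just x))))
      b≡b′ : b ≡ b′
      b≡b′ = trans (solve 2 (λ a b → b := a :* :0 :+ b) refl a b) (trans (values 0#) (solve 2 (λ a b → a :* :0 :+ b := b) refl a′ b′))
      a≡a′ : a ≡ a′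
      a≡a′ = trans (solve 2 (λ a b → a := a :* :1 :+ b :- b) refl a b)
               (trans (cong₂ _-_ (values 1#) b≡b′) (solve 2 (λ a b → a :* :1 :+ b :- b := a) refl a′ b′))

    isolated-vertices-surjective : ∀ π → Isolated π → ∃[ k ] proj₁ (isolated-vertices k) ≈ π
    isolated-vertices-surjective π π-isolated with Equivalence.to (isolated⇔affine π) π-isolated
    ... | a , b , a≢0 , π≗ with punchIn′-surjective {i = to 0#} {j = to a} (λ eq → a≢0 (to-injective (sym eq)))
    ... | k , punchIn′k≡a = combine (to b) k , λ x → begin
      apply (proj₁ (isolated-vertices (combine (to b) k))) x  ≡⟨ cong (λ p → apply (proj₁ (affine-at p)) x) (remQuot-combine (to b) k) ⟩
      apply (affinePGL (from (to b)) (nonzero≢0 k)) x        ≡⟨ affinePGL-affine (from (to b)) (nonzero≢0 k) x ⟩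
      affine (nonzero k) (from (to b)) x                      ≡⟨ cong₂ (λ a′ b′ → affine a′ b′ x)
                                                                   (trans (cong from punchIn′k≡a) (Inverse.strictlyInverseʳ enum a))
                                                                   (Inverse.strictlyInverseʳ enum b) ⟩
      affine a b x                                            ≡⟨ π≗ x ⟨
      apply π x                                               ∎
      where open ≡-Reasoning

theorem14 : (𝔽 : FiniteField) → let open GF 𝔽 in
    (∃[ p ] ∃[ m ] (Prime p × p % 2 ≡ 1 × q ≡ p ^ m)) →
    q % 3 ≡ 1 →
    13 ≤ q →
    -- (1) the isolated vertices are exactly the maps x ↦ ax+b, a ≠ 0 ...
    (∀ π → Isolated π ⇔ IsAffine π)
    -- ... and there are q(q-1) of them (as elements of PGL(2,q))
    × (Σ (Fin (q ℕ.* (q ∸ 1)) → Σ PGL Isolated) λ f →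
         (∀ i j → proj₁ (f i) ≈ proj₁ (f j) → i ≡ j)
         × (∀ π → Isolated π → ∃[ i ] (proj₁ (f i) ≈ π)))
    -- (2) for each r ≠ 0 the induced subgraph [P_r] is connected ...
    × (∀ r → ¬ (r ≡ 0#) → ∀ π σ → InP r π → InP r σ → PathIn (InP r) π σ)
    -- ... the P_r for distinct r are disjoint ...
    × (∀ r s → ¬ (r ≡ s) → ∀ π → InP r π → ¬ InP s π)
    -- ... and the connected components of C_P(q) are exactly the isolated
    -- vertices and the [P_r], r ≠ 0
    × (∀ π σ → PathIn Everything π σ ⇔
         (π ≈ σ ⊎ ∃[ r ] (¬ (r ≡ 0#) × InP r π × InP r σ)))
theorem14 𝔽 _ q%3≡1 13≤q with SixthRoot.primitiveSixthRoot 𝔽 q%3≡1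
... | u , u²-u+1≡0 , 2u≢1 =
  isolated⇔affine ,
  (isolated-vertices , isolated-vertices-injective , isolated-vertices-surjective) ,
  P-connected ,
  P-disjoint ,
  components
  where
  open Components 𝔽
  open WithSixthRoot u²-u+1≡0 2u≢1 (≤-trans (m≤m+n 5 8) 13≤q)
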